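{- Let $k_4$ be the morphism $\texttt{0}\mapsto\texttt{1232}$, $\texttt{1}\mapsto\texttt{12}$, $\texttt{2}\mapsto\texttt{10}$ and $k_3$ the morphism $\texttt{0}\mapsto\texttt{122}$, $\texttt{1}\mapsto\texttt{12}$, $\texttt{2}\mapsto\texttt{10}$. Then: (1) every bi-infinite overlap-free walk on $P_4$ has the same set of finite factors as $k_4(b_3)$; (2) every bi-infinite overlap-free walk on $P_3^\star$ has the same set of finite factors as $k_3(b_3)$.
   Context: $P_4$ is the undirected path with vertices $\texttt{0},\texttt{1},\texttt{2},\texttt{3}$ and edges $\texttt{01},\texttt{12},\texttt{23}$. $P_3^\star$ is the undirected path with vertices $\texttt{0},\texttt{1},\texttt{2}$ and edges $\texttt{01},\texttt{12}$, together with a loop at $\texttt{2}$. A walk on a graph is a word over its vertex set in which any two consecutive letters are joined by an edge (or loop). A word is overlap-free if it contains no factor $u^nv$ with $u$ nonempty, $v$ a prefix of $u$, and exponent $|u^nv|/|u|>2$. $b_3$ is the Hall–Thue word, the fixed point starting with $\texttt{0}$ of the morphism $\texttt{0}\mapsto\texttt{012}$, $\texttt{1}\mapsto\texttt{02}$, $\texttt{2}\mapsto\texttt{1}$. -}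

module Defs where

open import Data.Nat using (ℕ; zero; suc; _+_; _*_; _<_)
open import Data.Integer using (ℤ; 1ℤ) renaming (_+_ to _+ℤ_)
open import Data.Fin using (Fin; zero; suc)
open import Data.List using (List; []; _∷_; _++_; length; concat; concatMap; replicate)
open import Data.Product using (∃; _×_)
open import Relation.Binary.PropositionalEquality using (_≡_; _≢_)
open import Relation.Nullary using (¬_)

a0 : ∀ {n} → Fin (suc n)
a0 = zero
a1 : ∀ {n} → Fin (suc (suc n))
a1 = suc zero
a2 : ∀ {n} → Fin (suc (suc (suc n)))
a2 = suc (suc zero)
a3 : ∀ {n} → Fin (suc (suc (suc (suc n))))
a3 = suc (suc (suc zero))

IsPrefix : ∀ {A : Set} → List A → List A → Set
IsPrefix {A} v u = ∃ λ (t : List A) → v ++ t ≡ u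

pow : ∀ {A : Set} → List A → ℕ → List A
pow u n = concat (replicate n u)

sliceℤ : ∀ {A : Set} → (ℤ → A) → ℤ → ℕ → List A
sliceℤ x i zero = []
sliceℤ x i (suc n) = x i ∷ sliceℤ x (i +ℤ 1ℤ) n

FactorOfℤ : ∀ {A : Set} → List A → (ℤ → A) → Set
FactorOfℤ w x = ∃ λ (i : ℤ) → sliceℤ x i (length w) ≡ w

-- overlap-free: no factor u^n v with u nonempty, v a prefix of u,
-- and exponent |u^n v| / |u| > 2
OverlapFreeℤ : ∀ {A : Set} → (ℤ → A) → Set
OverlapFreeℤ {A} x = (u v : List A) (n : ℕ) → u ≢ [] → IsPrefix v u →
  2 * length u < length (pow u n ++ v) → ¬ FactorOfℤ (pow u n ++ v) x

IsWalkℤ : ∀ {A : Set} → (A → A → Set) → (ℤ → A) → Set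
IsWalkℤ E x = (i : ℤ) → E (x i) (x (i +ℤ 1ℤ))

sliceℕ : ∀ {A : Set} → (ℕ → A) → ℕ → ℕ → List A
sliceℕ y i zero = []
sliceℕ y i (suc n) = y i ∷ sliceℕ y (suc i) n

FactorOfℕ : ∀ {A : Set} → List A → (ℕ → A) → Set
FactorOfℕ w y = ∃ λ (i : ℕ) → sliceℕ y i (length w) ≡ w

nth : ∀ {A : Set} → A → List A → ℕ → A
nth d [] n = d
nth d (a ∷ w) zero = a
nth d (a ∷ w) (suc n) = nth d w n

iter : ∀ {A : Set} → (A → List A) → ℕ → List A → List A
iter h zero w = w
iter h (suc k) w = iter h k (concatMap h w)

-- image of an infinite word under a non-erasing morphism h : A → List B
-- (position n lies inside h(y 0 ... y n), whose length is > n)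
applyInf : ∀ {A B : Set} → B → (A → List B) → (ℕ → A) → ℕ → B
applyInf d h y n = nth d (concatMap h (sliceℕ y 0 (suc n))) n

hHT : Fin 3 → List (Fin 3)
hHT zero = a0 ∷ a1 ∷ a2 ∷ []
hHT (suc zero) = a0 ∷ a2 ∷ []
hHT (suc (suc zero)) = a1 ∷ []

-- b₃[n] is the n-th letter of hHT^(n+1)(0) (which has length > n)
b3 : ℕ → Fin 3
b3 n = nth a0 (iter hHT (suc n) (a0 ∷ [])) n

k4 : Fin 3 → List (Fin 4)
k4 zero = a1 ∷ a2 ∷ a3 ∷ a2 ∷ []
k4 (suc zero) = a1 ∷ a2 ∷ []
k4 (suc (suc zero)) = a1 ∷ a0 ∷ []

k3 : Fin 3 → List (Fin 3)
k3 zero = a1 ∷ a2 ∷ a2 ∷ []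
k3 (suc zero) = a1 ∷ a2 ∷ []
k3 (suc (suc zero)) = a1 ∷ a0 ∷ []

k4b3 : ℕ → Fin 4
k4b3 = applyInf a0 k4 b3

k3b3 : ℕ → Fin 3
k3b3 = applyInf a0 k3 b3

data EdgeP4 : Fin 4 → Fin 4 → Set where
  e01 : EdgeP4 a0 a1
  e10 : EdgeP4 a1 a0
  e12 : EdgeP4 a1 a2
  e21 : EdgeP4 a2 a1
  e23 : EdgeP4 a2 a3
  e32 : EdgeP4 a3 a2

data EdgeP3s : Fin 3 → Fin 3 → Set where
  e01 : EdgeP3s a0 a1
  e10 : EdgeP3s a1 a0
  e12 : EdgeP3s a1 a2
  e21 : EdgeP3s a2 a1
  e22 : EdgeP3s a2 a2

{-# OPTIONS --safe #-}
module Submission where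

-- Call a factorial, bi-extendable language over {0,1,2} a Thue language if it is square-free and
-- avoids 010 and 212. For such a language L the words u with h(a u b) ∈ L for some letters a, b
-- form again a Thue language, and every long word of L sits inside h(u) for such a u that is
-- strictly shorter (h expands by a factor 3/2, as 22 is a square); words of length at most 9 are
-- settled by an exhaustive search. So every word of L is a factor of some hⁿ(0); conversely
-- hⁿ(0) ∈ L by induction on n through the preimage languages. Thus L is the set of factors of b₃.
--
-- On P₄ and P₃⋆ the walk condition and overlap-freeness force a bi-infinite walk x to be a
-- concatenation of the blocks k(0), k(1), k(2), all of which begin with 1. The words u such that
-- k(u)1 is a factor of x then form a Thue language, because k(square)1 is an overlap; hence the
-- factors of x are the factors of the words k(hⁿ(0)), which are those of k(b₃).

open import Defs
import Algebra.Solver.Monoid as MonoidSolver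
open import Data.Bool using (Bool; true; false; _∧_; _∨_; T)
open import Data.Bool.Properties using (T-∧; T-∨)
open import Data.Empty using (⊥-elim)
open import Data.Fin using (Fin; zero; suc; _≟_)
open import Data.Integer using (ℤ; 1ℤ; -1ℤ; +_) renaming (_+_ to _+ℤ_)
import Data.Integer.Properties as ℤ
open import Data.List using (List; []; _∷_; _++_; length; concatMap; take; drop; initLast; _∷ʳ′_)
open import Data.List.Properties
  using (++-assoc; ++-identityʳ; length-++; ∷-injective; concatMap-++; take++drop≡id; ≡-dec; ++-monoid)
open import Data.Maybe using (Maybe; just; nothing; is-just)
open import Data.Nat using (ℕ; zero; suc; _+_; _*_; _∸_; _≤_; _<_; _≤?_; _≤′_; ≤′-refl; ≤′-step; _⊔_; s≤s; z≤n)
open import Data.Nat.Properties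
  using (≤-refl; ≤-reflexive; ≤-trans; ≤-pred; ≰⇒>; <⇒≤; ≤⇒≤′; n≤1+n; m≤m+n; m≤n+m; m≤m⊔n; m≤n⊔m;
         suc-injective; +-comm; +-assoc; +-identityʳ; +-suc; +-mono-≤; +-monoˡ-≤; +-monoʳ-≤; +-monoʳ-<;
         +-cancelˡ-≤; +-cancelʳ-≤; *-monoʳ-≤; *-cancelˡ-<; *-distribˡ-+; m+[n∸m]≡n; module ≤-Reasoning)
open import Data.Product using (∃; ∃₂; _×_; _,_; proj₁; proj₂)
open import Data.Sum using (inj₁; inj₂)
open import Function.Base using (_∘_)
open import Function.Bundles using (_⇔_; mk⇔; module Equivalence)
open import Function.Construct.Composition using (_⇔-∘_)
open import Function.Construct.Symmetry using (⇔-sym)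
open import Relation.Binary.Definitions using (DecidableEquality)
open import Relation.Binary.PropositionalEquality
open import Relation.Nullary using (¬_; yes; no)
open import Relation.Nullary.Decidable using (⌊_⌋; toWitness; from-yes; from-no)

open Equivalence using (to)

pattern 𝟎 = zero
pattern 𝟏 = suc zero
pattern 𝟐 = suc (suc zero)
pattern 𝟑 = suc (suc (suc zero))

Word₃ : Set
Word₃ = List (Fin 3)

Infix : {A : Set} → List A → List A → Set
Infix {A} v w = ∃₂ λ (p s : List A) → w ≡ p ++ v ++ s

module _ {A : Set} where

  infix-trans : {u v w : List A} → Infix u v → Infix v w → Infix u w
  infix-trans {u} (p , s , refl) (p′ , s′ , refl) =
    p′ ++ p , s ++ s′ , (begin
      p′ ++ (p ++ u ++ s) ++ s′   ≡⟨ cong (p′ ++_) (++-assoc p (u ++ s) s′) ⟩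
      p′ ++ p ++ (u ++ s) ++ s′   ≡⟨ cong (λ z → p′ ++ p ++ z) (++-assoc u s s′) ⟩
      p′ ++ p ++ u ++ s ++ s′     ≡⟨ ++-assoc p′ p (u ++ s ++ s′) ⟨
      (p′ ++ p) ++ u ++ s ++ s′   ∎)
    where open ≡-Reasoning

  infix-++ʳ : (v s : List A) → Infix v (v ++ s)
  infix-++ʳ v s = [] , s , refl

  take-length-++ : (xs ys : List A) → take (length xs) (xs ++ ys) ≡ xs
  take-length-++ []       ys = refl
  take-length-++ (x ∷ xs) ys = cong (x ∷_) (take-length-++ xs ys)

  drop-length-++ : (xs ys : List A) → drop (length xs) (xs ++ ys) ≡ ys
  drop-length-++ []       ys = refl
  drop-length-++ (x ∷ xs) ys = drop-length-++ xs ys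

  ++-split : (xs ys zs ws : List A) → xs ++ ys ≡ zs ++ ws → length xs ≤ length zs →
             ∃ λ t → zs ≡ xs ++ t × ys ≡ t ++ ws
  ++-split []       ys zs       ws eq _         = zs , refl , eq
  ++-split (x ∷ xs) ys (z ∷ zs) ws eq (s≤s le) with ∷-injective eq
  ... | refl , eq′ with ++-split xs ys zs ws eq′ le
  ... | t , refl , ys≡ = t , refl , ys≡

  ++-splitʳ : (xs ys zs ws : List A) → xs ++ ys ≡ zs ++ ws → length ys ≤ length ws →
              ∃ λ t → xs ≡ zs ++ t × ws ≡ t ++ ys
  ++-splitʳ xs ys zs ws eq le = ++-split zs ws xs ys (sym eq) (+-cancelʳ-≤ (length ys) _ _ (begin
    length zs + length ys   ≤⟨ +-monoʳ-≤ (length zs) le ⟩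
    length zs + length ws   ≡⟨ length-++ zs ⟨
    length (zs ++ ws)       ≡⟨ cong length eq ⟨
    length (xs ++ ys)       ≡⟨ length-++ xs ⟩
    length xs + length ys   ∎))
    where open ≤-Reasoning

  ++-injective : (xs ys zs ws : List A) → length xs ≡ length zs → xs ++ ys ≡ zs ++ ws →
                 xs ≡ zs × ys ≡ ws
  ++-injective []       ys []       ws _   eq = refl , eq
  ++-injective (x ∷ xs) ys (z ∷ zs) ws len eq with ∷-injective eq
  ... | refl , eq′ with ++-injective xs ys zs ws (suc-injective len) eq′
  ... | refl , ys≡ws = refl , ys≡ws

  infix-inner : (x₁ w x₂ y₁ m y₂ : List A) → x₁ ++ w ++ x₂ ≡ y₁ ++ m ++ y₂ →
                length y₁ ≤ length x₁ → length y₂ ≤ length x₂ → Infix w m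
  infix-inner x₁ w x₂ y₁ m y₂ eq l₁ l₂ with ++-split y₁ (m ++ y₂) x₁ (w ++ x₂) (sym eq) l₁
  ... | t , refl , m++y₂≡ with ++-splitʳ m y₂ (t ++ w) x₂ (trans m++y₂≡ (sym (++-assoc t w x₂))) l₂
  ... | t′ , m≡ , _ = t , t′ , trans m≡ (++-assoc t w t′)

record Biextendable {A : Set} (L : List A → Set) : Set where
  field
    contains-[]   : L []
    prefix-closed : ∀ w s → L (w ++ s) → L w
    suffix-closed : ∀ p w → L (p ++ w) → L w
    extendʳ       : ∀ w → L w → ∃ λ d → L (w ++ d ∷ [])
    extendˡ       : ∀ w → L w → ∃ λ d → L (d ∷ w)

  infix-closed : ∀ p w s → L (p ++ w ++ s) → L w
  infix-closed p w s h = prefix-closed w s (suffix-closed p (w ++ s) h)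

  Infix-closed : ∀ {v w} → Infix v w → L w → L v
  Infix-closed (p , s , refl) = infix-closed p _ s

  extendʳ* : ∀ n w → L w → ∃ λ t → length t ≡ n × L (w ++ t)
  extendʳ* zero    w h = [] , refl , subst L (sym (++-identityʳ w)) h
  extendʳ* (suc n) w h with extendʳ w h
  ... | d , h′ with extendʳ* n (w ++ d ∷ []) h′
  ... | t , refl , h″ = d ∷ t , refl , subst L (++-assoc w (d ∷ []) t) h″

  extendˡ* : ∀ n w → L w → ∃ λ p → length p ≡ n × L (p ++ w)
  extendˡ* zero    w h = [] , refl , h
  extendˡ* (suc n) w h with extendˡ w h
  ... | d , h′ with extendˡ* n (d ∷ w) h′
  ... | p , refl , h″ = p ++ d ∷ [] , trans (length-++ p) (+-comm (length p) 1) ,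
                        subst L (sym (++-assoc p (d ∷ []) w)) h″

module _ {A : Set} (x : ℤ → A) where

  length-sliceℤ : ∀ i n → length (sliceℤ x i n) ≡ n
  length-sliceℤ i zero    = refl
  length-sliceℤ i (suc n) = cong suc (length-sliceℤ (i +ℤ 1ℤ) n)

  sliceℤ-+ : ∀ i m n → sliceℤ x i (m + n) ≡ sliceℤ x i m ++ sliceℤ x (i +ℤ + m) n
  sliceℤ-+ i zero    n rewrite ℤ.+-identityʳ i = refl
  sliceℤ-+ i (suc m) n rewrite sliceℤ-+ (i +ℤ 1ℤ) m n | ℤ.+-assoc i 1ℤ (+ m) = refl

  private
    split-factor : ∀ i u v → sliceℤ x i (length (u ++ v)) ≡ u ++ v →
                   sliceℤ x i (length u) ≡ u × sliceℤ x (i +ℤ + length u) (length v) ≡ v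
    split-factor i u v eq = ++-injective _ _ u v (length-sliceℤ i (length u))
      (trans (sym (sliceℤ-+ i (length u) (length v))) (trans (cong (sliceℤ x i) (sym (length-++ u))) eq))

  factorsℤ-biextendable : Biextendable (λ w → FactorOfℤ w x)
  factorsℤ-biextendable = record
    { contains-[]   = + 0 , refl
    ; prefix-closed = λ w s (i , eq) → i , proj₁ (split-factor i w s eq)
    ; suffix-closed = λ p w (i , eq) → i +ℤ + length p , proj₂ (split-factor i p w eq)
    ; extendʳ       = extendʳ
    ; extendˡ       = extendˡ
    }
    where
    extendʳ : ∀ w → FactorOfℤ w x → ∃ λ d → FactorOfℤ (w ++ d ∷ []) x
    extendʳ w (i , eq) = x (i +ℤ + length w) , i ,
      trans (cong (sliceℤ x i) (length-++ w))
        (trans (sliceℤ-+ i (length w) 1) (cong (_++ x (i +ℤ + length w) ∷ []) eq))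

    extendˡ : ∀ w → FactorOfℤ w x → ∃ λ d → FactorOfℤ (d ∷ w) x
    extendˡ w (i , eq) = x (i +ℤ -1ℤ) , i +ℤ -1ℤ ,
      cong (x (i +ℤ -1ℤ) ∷_) (trans (cong (λ j → sliceℤ x j (length w)) i-1+1≡i) eq)
      where
      i-1+1≡i : i +ℤ -1ℤ +ℤ 1ℤ ≡ i
      i-1+1≡i = trans (ℤ.+-assoc i -1ℤ 1ℤ) (ℤ.+-identityʳ i)

  overlap-free⇒¬auaua : OverlapFreeℤ x → ∀ a u → ¬ FactorOfℤ ((a ∷ u) ++ (a ∷ u) ++ a ∷ []) x
  overlap-free⇒¬auaua free a u h =
    free (a ∷ u) (a ∷ []) 2 (λ ()) (u , refl) shorter (subst (λ z → FactorOfℤ z x) (sym auaua≡) h)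
    where
    auaua≡ : pow (a ∷ u) 2 ++ a ∷ [] ≡ (a ∷ u) ++ (a ∷ u) ++ a ∷ []
    auaua≡ rewrite ++-identityʳ (a ∷ u) = ++-assoc (a ∷ u) (a ∷ u) (a ∷ [])

    length-vvb : ∀ (v : List A) b → length (v ++ v ++ b ∷ []) ≡ suc (2 * length v)
    length-vvb v b = begin
      length (v ++ v ++ b ∷ [])         ≡⟨ length-++ v ⟩
      length v + length (v ++ b ∷ [])   ≡⟨ cong (λ m → length v + m) (trans (length-++ v) (+-comm (length v) 1)) ⟩
      length v + suc (length v)         ≡⟨ +-suc (length v) (length v) ⟩
      suc (length v + length v)         ≡⟨ cong (λ m → suc (length v + m)) (+-identityʳ (length v)) ⟨
      suc (2 * length v)                ∎
      where open ≡-Reasoning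

    shorter : 2 * length (a ∷ u) < length (pow (a ∷ u) 2 ++ a ∷ [])
    shorter = ≤-reflexive (sym (trans (cong length auaua≡) (length-vvb (a ∷ u) a)))

  walk-edge : {E : A → A → Set} → IsWalkℤ E x → ∀ a b w → FactorOfℤ (a ∷ b ∷ w) x → E a b
  walk-edge {E} walk a b w (i , eq) with ∷-injective eq
  ... | xi≡a , eq′ with ∷-injective eq′
  ... | xi+1≡b , _ = subst₂ E xi≡a xi+1≡b (walk i)

  walk-edge-at : {E : A → A → Set} → IsWalkℤ E x → ∀ p a b w → FactorOfℤ (p ++ a ∷ b ∷ w) x → E a b
  walk-edge-at walk p a b w h = walk-edge walk a b w (Biextendable.suffix-closed factorsℤ-biextendable p _ h)

  walk-extendˡ : {E : A → A → Set} → IsWalkℤ E x → ∀ c w → FactorOfℤ (c ∷ w) x →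
                 ∃ λ d → E d c × FactorOfℤ (d ∷ c ∷ w) x
  walk-extendˡ walk c w h with Biextendable.extendˡ factorsℤ-biextendable (c ∷ w) h
  ... | d , h′ = d , walk-edge walk d c w h′ , h′

h* : Word₃ → Word₃
h* = concatMap hHT

h*-++ : ∀ u v → h* (u ++ v) ≡ h* u ++ h* v
h*-++ = concatMap-++ hHT

h*-∷ʳ : ∀ u b → h* (u ++ b ∷ []) ≡ h* u ++ hHT b
h*-∷ʳ u b = trans (h*-++ u (b ∷ [])) (cong (h* u ++_) (++-identityʳ (hHT b)))

length-h≤3 : ∀ a → length (hHT a) ≤ 3
length-h≤3 𝟎 = s≤s (s≤s (s≤s z≤n))
length-h≤3 𝟏 = s≤s (s≤s z≤n)
length-h≤3 𝟐 = s≤s z≤n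

1≤length-h : ∀ a → 1 ≤ length (hHT a)
1≤length-h 𝟎 = s≤s z≤n
1≤length-h 𝟏 = s≤s z≤n
1≤length-h 𝟐 = s≤s z≤n

h^ : ℕ → Word₃
h^ n = iter hHT n (𝟎 ∷ [])

h^-suc : ∀ n → h^ (suc n) ≡ h* (h^ n)
h^-suc n = iter-suc n (𝟎 ∷ [])
  where
  iter-suc : ∀ n w → iter hHT (suc n) w ≡ h* (iter hHT n w)
  iter-suc zero    w = refl
  iter-suc (suc n) w = iter-suc n (h* w)

h*-infix : ∀ {u w} → Infix u w → Infix (h* u) (h* w)
h*-infix {u} (p , s , refl) = h* p , h* s , trans (h*-++ p (u ++ s)) (cong (h* p ++_) (h*-++ u s))

HallThueFactor : Word₃ → Set
HallThueFactor w = ∃ λ n → Infix w (h^ n)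

HallThueFactor-h* : ∀ {u} → HallThueFactor u → HallThueFactor (h* u)
HallThueFactor-h* (n , u⊑) = suc n , subst (Infix _) (sym (h^-suc n)) (h*-infix u⊑)

HallThueFactor-infix : ∀ {v w} → Infix v w → HallThueFactor w → HallThueFactor v
HallThueFactor-infix v⊑w (n , w⊑) = n , infix-trans v⊑w w⊑

record ThueLanguage (L : Word₃ → Set) : Set where
  field
    biextendable : Biextendable L
    square-free  : ∀ a u → ¬ L ((a ∷ u) ++ (a ∷ u))
    ∌010         : ¬ L (𝟎 ∷ 𝟏 ∷ 𝟎 ∷ [])
    ∌212         : ¬ L (𝟐 ∷ 𝟏 ∷ 𝟐 ∷ [])
  open Biextendable biextendable public

_≟ʷ_ : DecidableEquality Word₃
_≟ʷ_ = ≡-dec _≟_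

hasSquarePrefixOfLength : ℕ → Word₃ → Bool
hasSquarePrefixOfLength p w with take p w
... | []    = false
... | a ∷ u = ⌊ (a ∷ u) ≟ʷ take p (drop p w) ⌋

hasSquarePrefix : ℕ → Word₃ → Bool
hasSquarePrefix zero    w = false
hasSquarePrefix (suc p) w = hasSquarePrefixOfLength (suc p) w ∨ hasSquarePrefix p w

startsWith : Word₃ → Word₃ → Bool
startsWith u w = ⌊ u ≟ʷ take (length u) w ⌋

forbiddenPrefix : Word₃ → Bool
forbiddenPrefix w = hasSquarePrefix (length w) w ∨ startsWith (𝟎 ∷ 𝟏 ∷ 𝟎 ∷ []) w ∨ startsWith (𝟐 ∷ 𝟏 ∷ 𝟐 ∷ []) w

forbidden : Word₃ → Bool
forbidden []      = false
forbidden (c ∷ w) = forbiddenPrefix (c ∷ w) ∨ forbidden w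

occursIn : Word₃ → Word₃ → Bool
occursIn v []      = startsWith v []
occursIn v (c ∷ w) = startsWith v (c ∷ w) ∨ occursIn v w

-- A word of length at most 9 may pass the local test without being a factor of b₃, but not once
-- it is extended by three letters on each side; hence the window of length 9 at offset 3.
windowOccurs : Word₃ → Bool
windowOccurs w = occursIn (take 9 (drop 3 w)) (h^ 6)

forAllLetters : (Fin 3 → Bool) → Bool
forAllLetters p = p 𝟎 ∧ p 𝟏 ∧ p 𝟐

forAllLetters-sound : ∀ p → T (forAllLetters p) → ∀ c → T (p c)
forAllLetters-sound p t 𝟎 = proj₁ (to (T-∧ {p 𝟎}) t)
forAllLetters-sound p t 𝟏 = proj₁ (to (T-∧ {p 𝟏}) (proj₂ (to (T-∧ {p 𝟎}) t)))
forAllLetters-sound p t 𝟐 = proj₂ (to (T-∧ {p 𝟏}) (proj₂ (to (T-∧ {p 𝟎}) t)))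

coveredExtensions : ℕ → Word₃ → Bool
coveredExtensions zero    w = windowOccurs w
coveredExtensions (suc k) w =
  forAllLetters λ c → forbidden (w ++ c ∷ []) ∨ coveredExtensions k (w ++ c ∷ [])

all-length-15-covered : T (coveredExtensions 15 [])
all-length-15-covered = _

startsWith-sound : ∀ u w → T (startsWith u w) → ∃ λ s → w ≡ u ++ s
startsWith-sound u w t = drop (length u) w ,
  trans (sym (take++drop≡id (length u) w)) (cong (_++ drop (length u) w) (sym (toWitness t)))

occursIn-sound : ∀ v w → T (occursIn v w) → Infix v w
occursIn-sound v [] t with startsWith-sound v [] t
... | s , eq = [] , s , eq
occursIn-sound v (c ∷ w) t with to (T-∨ {startsWith v (c ∷ w)}) t
... | inj₁ t₁ with startsWith-sound v (c ∷ w) t₁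
...   | s , eq = [] , s , eq
occursIn-sound v (c ∷ w) t | inj₂ t₂ with occursIn-sound v w t₂
...   | p , s , eq = c ∷ p , s , cong (c ∷_) eq

module _ {L : Word₃ → Set} (thue : ThueLanguage L) where
  open ThueLanguage thue

  squarePrefix-∉ : ∀ p w → T (hasSquarePrefixOfLength p w) → ¬ L w
  squarePrefix-∉ p w t h with take p w in eq
  ... | a ∷ u = square-free a u (prefix-closed _ _ (subst L w≡ h))
    where
    open ≡-Reasoning
    rest : Word₃
    rest = drop p (drop p w)
    w≡ : w ≡ ((a ∷ u) ++ (a ∷ u)) ++ rest
    w≡ = begin
      w                                       ≡⟨ take++drop≡id p w ⟨
      take p w ++ drop p w                    ≡⟨ cong (_++ drop p w) eq ⟩
      (a ∷ u) ++ drop p w                     ≡⟨ cong ((a ∷ u) ++_) (take++drop≡id p (drop p w)) ⟨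
      (a ∷ u) ++ take p (drop p w) ++ rest    ≡⟨ cong (λ z → (a ∷ u) ++ z ++ rest) (toWitness t) ⟨
      (a ∷ u) ++ (a ∷ u) ++ rest              ≡⟨ ++-assoc (a ∷ u) (a ∷ u) rest ⟨
      ((a ∷ u) ++ (a ∷ u)) ++ rest            ∎

  hasSquarePrefix-∉ : ∀ p w → T (hasSquarePrefix p w) → ¬ L w
  hasSquarePrefix-∉ (suc p) w t with to (T-∨ {hasSquarePrefixOfLength (suc p) w}) t
  ... | inj₁ t₁ = squarePrefix-∉ (suc p) w t₁
  ... | inj₂ t₂ = hasSquarePrefix-∉ p w t₂

  startsWith-∉ : ∀ u w → ¬ L u → T (startsWith u w) → ¬ L w
  startsWith-∉ u w u∉ t h with startsWith-sound u w t
  ... | s , refl = u∉ (prefix-closed u s h)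

  forbiddenPrefix-∉ : ∀ w → T (forbiddenPrefix w) → ¬ L w
  forbiddenPrefix-∉ w t with to (T-∨ {hasSquarePrefix (length w) w}) t
  ... | inj₁ square = hasSquarePrefix-∉ (length w) w square
  ... | inj₂ t′ with to (T-∨ {startsWith (𝟎 ∷ 𝟏 ∷ 𝟎 ∷ []) w}) t′
  ...   | inj₁ starts010 = startsWith-∉ _ w ∌010 starts010
  ...   | inj₂ starts212 = startsWith-∉ _ w ∌212 starts212

  forbidden-∉ : ∀ w → T (forbidden w) → ¬ L w
  forbidden-∉ (c ∷ w) t h with to (T-∨ {forbiddenPrefix (c ∷ w)}) t
  ... | inj₁ here  = forbiddenPrefix-∉ (c ∷ w) here h
  ... | inj₂ later = forbidden-∉ w later (suffix-closed (c ∷ []) w h)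

  coveredExtensions-sound : ∀ k w → T (coveredExtensions k w) →
    ∀ t → length t ≡ k → L (w ++ t) → T (windowOccurs (w ++ t))
  coveredExtensions-sound zero w covered [] _ h rewrite ++-identityʳ w = covered
  coveredExtensions-sound (suc k) w covered (c ∷ t) len h
    with to (T-∨ {forbidden (w ++ c ∷ [])}) (forAllLetters-sound (λ d → forbidden (w ++ d ∷ []) ∨ coveredExtensions k (w ++ d ∷ [])) covered c)
  ... | inj₁ bad = ⊥-elim (forbidden-∉ _ bad (prefix-closed (w ++ c ∷ []) t (subst L (sym (++-assoc w (c ∷ []) t)) h)))
  ... | inj₂ rec = subst (T ∘ windowOccurs) (++-assoc w (c ∷ []) t)
          (coveredExtensions-sound k (w ++ c ∷ []) rec t (suc-injective len) (subst L (sym (++-assoc w (c ∷ []) t)) h))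

  short-factor : ∀ w → length w ≤ 9 → L w → HallThueFactor w
  short-factor w w≤9 w∈ with extendʳ* (9 ∸ length w) w w∈
  ... | t , lt , wt∈ with extendˡ* 3 (w ++ t) wt∈
  ... | p , lp , pwt∈ with extendʳ* 3 (p ++ w ++ t) pwt∈
  ... | s , ls , pwts∈ = 6 , infix-trans (infix-++ʳ w t) (occursIn-sound (w ++ t) (h^ 6) window-occurs)
    where
    open ≡-Reasoning
    length-wt : length (w ++ t) ≡ 9
    length-wt = trans (length-++ w) (trans (cong (_+_ (length w)) lt) (m+[n∸m]≡n w≤9))

    length-pwts : length ((p ++ w ++ t) ++ s) ≡ 15
    length-pwts = trans (length-++ (p ++ w ++ t)) (cong₂ _+_ (trans (length-++ p) (cong₂ _+_ lp length-wt)) ls)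

    window : take 9 (drop 3 ((p ++ w ++ t) ++ s)) ≡ w ++ t
    window = begin
      take 9 (drop 3 ((p ++ w ++ t) ++ s))            ≡⟨ cong (take 9 ∘ drop 3) (++-assoc p (w ++ t) s) ⟩
      take 9 (drop 3 (p ++ (w ++ t) ++ s))            ≡⟨ cong (λ n → take 9 (drop n (p ++ (w ++ t) ++ s))) lp ⟨
      take 9 (drop (length p) (p ++ (w ++ t) ++ s))   ≡⟨ cong (take 9) (drop-length-++ p _) ⟩
      take 9 ((w ++ t) ++ s)                          ≡⟨ cong (λ n → take n ((w ++ t) ++ s)) length-wt ⟨
      take (length (w ++ t)) ((w ++ t) ++ s)          ≡⟨ take-length-++ (w ++ t) s ⟩
      w ++ t                                          ∎

    window-occurs : T (occursIn (w ++ t) (h^ 6))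
    window-occurs = subst (λ v → T (occursIn v (h^ 6))) window
      (coveredExtensions-sound 15 [] all-length-15-covered _ length-pwts pwts∈)

Preimage : (Word₃ → Set) → Word₃ → Set
Preimage L u = ∃₂ λ a b → L (hHT a ++ h* u ++ hHT b)

blocks-end-in-nonzero : ∀ a u → ∃₂ λ v e → hHT a ++ h* u ≡ v ++ e ∷ [] × e ≢ 𝟎
blocks-end-in-nonzero 𝟎 []      = 𝟎 ∷ 𝟏 ∷ [] , 𝟐 , refl , λ ()
blocks-end-in-nonzero 𝟏 []      = 𝟎 ∷ [] , 𝟐 , refl , λ ()
blocks-end-in-nonzero 𝟐 []      = [] , 𝟏 , refl , λ ()
blocks-end-in-nonzero a (c ∷ u) with blocks-end-in-nonzero c u
... | v , e , eq , e≢𝟎 = hHT a ++ v , e , trans (cong (hHT a ++_) eq) (sym (++-assoc (hHT a) v (e ∷ []))) , e≢𝟎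

blocks-start-with-non2 : ∀ u b → ∃₂ λ f v → h* u ++ hHT b ≡ f ∷ v × f ≢ 𝟐
blocks-start-with-non2 []      𝟎 = 𝟎 , _ , refl , λ ()
blocks-start-with-non2 []      𝟏 = 𝟎 , _ , refl , λ ()
blocks-start-with-non2 []      𝟐 = 𝟏 , _ , refl , λ ()
blocks-start-with-non2 (𝟎 ∷ u) b = 𝟎 , _ , refl , λ ()
blocks-start-with-non2 (𝟏 ∷ u) b = 𝟎 , _ , refl , λ ()
blocks-start-with-non2 (𝟐 ∷ u) b = 𝟏 , _ , refl , λ ()

leadingBlock : Fin 3 → Fin 3 → Fin 3 → Maybe (Fin 3)
leadingBlock 𝟏 _ _ = just 𝟐
leadingBlock 𝟎 𝟐 _ = just 𝟏
leadingBlock 𝟎 𝟏 𝟐 = just 𝟎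
leadingBlock _ _ _ = nothing

leadingBlock-sound : ∀ x y z c → leadingBlock x y z ≡ just c → ∃ λ t → x ∷ y ∷ z ∷ [] ≡ hHT c ++ t
leadingBlock-sound 𝟏 y z .𝟐 refl = y ∷ z ∷ [] , refl
leadingBlock-sound 𝟎 𝟐 z .𝟏 refl = z ∷ [] , refl
leadingBlock-sound 𝟎 𝟏 𝟐 .𝟎 refl = [] , refl

trailingBlock : Fin 3 → Fin 3 → Fin 3 → Maybe (Fin 3)
trailingBlock _ _ 𝟏 = just 𝟐
trailingBlock _ 𝟎 𝟐 = just 𝟏
trailingBlock 𝟎 𝟏 𝟐 = just 𝟎
trailingBlock _ _ _ = nothing

trailingBlock-sound : ∀ x y z c → trailingBlock x y z ≡ just c → ∃ λ t → x ∷ y ∷ z ∷ [] ≡ t ++ hHT c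
trailingBlock-sound x y 𝟏 .𝟐 refl = x ∷ y ∷ [] , refl
trailingBlock-sound x 𝟎 𝟐 .𝟏 refl = x ∷ [] , refl
trailingBlock-sound 𝟎 𝟏 𝟐 .𝟎 refl = [] , refl

forAll5 : (Fin 3 → Fin 3 → Fin 3 → Fin 3 → Fin 3 → Bool) → Bool
forAll5 p = forAllLetters λ a → forAllLetters λ b → forAllLetters λ c → forAllLetters λ d → forAllLetters λ e → p a b c d e

forAll5-sound : ∀ p → T (forAll5 p) → ∀ a b c d e → T (p a b c d e)
forAll5-sound p t a b c d e =
  forAllLetters-sound (p a b c d)
    (forAllLetters-sound (λ d → forAllLetters (p a b c d))
      (forAllLetters-sound (λ c → forAllLetters λ d → forAllLetters (p a b c d))
        (forAllLetters-sound (λ b → forAllLetters λ c → forAllLetters λ d → forAllLetters (p a b c d))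
          (forAllLetters-sound (λ a → forAllLetters λ b → forAllLetters λ c → forAllLetters λ d → forAllLetters (p a b c d))
            t a) b) c) d) e

isZero : Fin 3 → Bool
isZero 𝟎 = true
isZero _ = false

isTwo : Fin 3 → Bool
isTwo 𝟐 = true
isTwo _ = false

-- A nonzero letter ends a block, so a block h(b) preceded by it is followed within three letters
-- by a further block; dually, a block followed by a letter other than 2 is preceded by one.
nextBlockForced : Fin 3 → Fin 3 → Fin 3 → Fin 3 → Fin 3 → Bool
nextBlockForced e b x y z = isZero e ∨ is-just (leadingBlock x y z) ∨ forbidden (e ∷ hHT b ++ x ∷ y ∷ z ∷ [])

previousBlockForced : Fin 3 → Fin 3 → Fin 3 → Fin 3 → Fin 3 → Bool
previousBlockForced x y z a f = isTwo f ∨ is-just (trailingBlock x y z) ∨ forbidden (x ∷ y ∷ z ∷ hHT a ++ f ∷ [])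

next-block-forced : ∀ e b x y z → e ≢ 𝟎 → leadingBlock x y z ≡ nothing →
                    T (forbidden (e ∷ hHT b ++ x ∷ y ∷ z ∷ []))
next-block-forced e b x y z e≢𝟎 none with forAll5-sound nextBlockForced _ e b x y z
next-block-forced 𝟎 b x y z e≢𝟎 none | _ = ⊥-elim (e≢𝟎 refl)
next-block-forced 𝟏 b x y z e≢𝟎 none | t rewrite none = t
next-block-forced 𝟐 b x y z e≢𝟎 none | t rewrite none = t

previous-block-forced : ∀ x y z a f → f ≢ 𝟐 → trailingBlock x y z ≡ nothing →
                        T (forbidden (x ∷ y ∷ z ∷ hHT a ++ f ∷ []))
previous-block-forced x y z a f f≢𝟐 none with forAll5-sound previousBlockForced _ x y z a f
previous-block-forced x y z a 𝟎 f≢𝟐 none | t rewrite none = t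
previous-block-forced x y z a 𝟏 f≢𝟐 none | t rewrite none = t
previous-block-forced x y z a 𝟐 f≢𝟐 none | _ = ⊥-elim (f≢𝟐 refl)

growth-step : ∀ k c n m → 3 * k ≤ 2 * c → 3 * n ≤ 2 * m + 1 → 3 * (k + n) ≤ 2 * (c + m) + 1
growth-step k c n m k≤c n≤m rewrite *-distribˡ-+ 3 k n | *-distribˡ-+ 2 c m | +-assoc (2 * c) (2 * m) 1 =
  +-mono-≤ k≤c n≤m

module _ {L : Word₃ → Set} (thue : ThueLanguage L) where
  open ThueLanguage thue
  open MonoidSolver (++-monoid (Fin 3)) using (solve; _⊕_; _⊜_)

  ∉-prefix : ∀ w s → T (forbidden w) → ¬ L (w ++ s)
  ∉-prefix w s t h = forbidden-∉ thue w t (prefix-closed w s h)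

  blocks-∈ : ∀ u → Preimage L u → L (h* u)
  blocks-∈ u (a , b , h) = infix-closed (hHT a) _ (hHT b) h

  preimage-prefix-closed : ∀ w s → Preimage L (w ++ s) → Preimage L w
  preimage-prefix-closed w []      h           = subst (Preimage L) (++-identityʳ w) h
  preimage-prefix-closed w (c ∷ s) (a , b , h) =
    a , c , prefix-closed (hHT a ++ h* w ++ hHT c) (h* s ++ hHT b) (subst L eq h)
    where
    eq : hHT a ++ h* (w ++ c ∷ s) ++ hHT b ≡ (hHT a ++ h* w ++ hHT c) ++ (h* s ++ hHT b)
    eq rewrite h*-++ w (c ∷ s) =
      solve 5 (λ A W C S B → A ⊕ (W ⊕ (C ⊕ S)) ⊕ B ⊜ (A ⊕ W ⊕ C) ⊕ (S ⊕ B)) refl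
        (hHT a) (h* w) (hHT c) (h* s) (hHT b)

  preimage-suffix-closed : ∀ p w → Preimage L (p ++ w) → Preimage L w
  preimage-suffix-closed []      w h           = h
  preimage-suffix-closed (c ∷ p) w (a , b , h) =
    preimage-suffix-closed p w (c , b , suffix-closed (hHT a) _ (subst L eq h))
    where
    eq : hHT a ++ h* (c ∷ p ++ w) ++ hHT b ≡ hHT a ++ (hHT c ++ h* (p ++ w) ++ hHT b)
    eq = cong (hHT a ++_) (++-assoc (hHT c) (h* (p ++ w)) (hHT b))

  preimage-square-free : ∀ a u → ¬ Preimage L ((a ∷ u) ++ (a ∷ u))
  preimage-square-free a u h = square-of-blocks a (subst L (h*-++ (a ∷ u) (a ∷ u)) (blocks-∈ ((a ∷ u) ++ (a ∷ u)) h))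
    where
    square-of-blocks : ∀ a → ¬ L ((hHT a ++ h* u) ++ (hHT a ++ h* u))
    square-of-blocks 𝟎 = square-free 𝟎 (𝟏 ∷ 𝟐 ∷ h* u)
    square-of-blocks 𝟏 = square-free 𝟎 (𝟐 ∷ h* u)
    square-of-blocks 𝟐 = square-free 𝟏 (h* u)

  preimage-∌010 : ¬ Preimage L (𝟎 ∷ 𝟏 ∷ 𝟎 ∷ [])
  preimage-∌010 h = forbidden-∉ thue (h* (𝟎 ∷ 𝟏 ∷ 𝟎 ∷ [])) _ (blocks-∈ (𝟎 ∷ 𝟏 ∷ 𝟎 ∷ []) h)

  preimage-∌212 : ¬ Preimage L (𝟐 ∷ 𝟏 ∷ 𝟐 ∷ [])
  preimage-∌212 (𝟎 , 𝟎 , h) = forbidden-∉ thue _ _ h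
  preimage-∌212 (𝟎 , 𝟏 , h) = forbidden-∉ thue _ _ h
  preimage-∌212 (𝟎 , 𝟐 , h) = forbidden-∉ thue _ _ h
  preimage-∌212 (𝟏 , 𝟎 , h) = forbidden-∉ thue _ _ h
  preimage-∌212 (𝟏 , 𝟏 , h) = forbidden-∉ thue _ _ h
  preimage-∌212 (𝟏 , 𝟐 , h) = forbidden-∉ thue _ _ h
  preimage-∌212 (𝟐 , b , h) = ∉-prefix (𝟏 ∷ 𝟏 ∷ []) _ _ h

  preimage-extendʳ : ∀ u → Preimage L u → ∃ λ d → Preimage L (u ++ d ∷ [])
  preimage-extendʳ u (a , b , h) with blocks-end-in-nonzero a u | extendʳ* 3 (hHT a ++ h* u ++ hHT b) h
  ... | v , e , v-e , e≢𝟎 | x ∷ y ∷ z ∷ [] , _ , h₃ with leadingBlock x y z in found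
  ...   | just c with leadingBlock-sound x y z c found
  ...     | t , xyz≡ = b , a , c , subst L extended (prefix-closed _ t (subst L split h₃))
    where
    split : (hHT a ++ h* u ++ hHT b) ++ x ∷ y ∷ z ∷ [] ≡ ((hHT a ++ h* u ++ hHT b) ++ hHT c) ++ t
    split = trans (cong ((hHT a ++ h* u ++ hHT b) ++_) xyz≡) (sym (++-assoc (hHT a ++ h* u ++ hHT b) (hHT c) t))
    extended : (hHT a ++ h* u ++ hHT b) ++ hHT c ≡ hHT a ++ h* (u ++ b ∷ []) ++ hHT c
    extended rewrite h*-∷ʳ u b =
      solve 4 (λ A U B C → (A ⊕ U ⊕ B) ⊕ C ⊜ A ⊕ (U ⊕ B) ⊕ C) refl (hHT a) (h* u) (hHT b) (hHT c)
  preimage-extendʳ u (a , b , h) | v , e , v-e , e≢𝟎 | x ∷ y ∷ z ∷ [] , _ , h₃ | nothing =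
    ⊥-elim (forbidden-∉ thue _ (next-block-forced e b x y z e≢𝟎 found) (suffix-closed v _ (subst L split h₃)))
    where
    xyz : Word₃
    xyz = x ∷ y ∷ z ∷ []
    split : (hHT a ++ h* u ++ hHT b) ++ xyz ≡ v ++ (e ∷ hHT b ++ xyz)
    split = trans (solve 4 (λ A U B D → (A ⊕ U ⊕ B) ⊕ D ⊜ (A ⊕ U) ⊕ (B ⊕ D)) refl (hHT a) (h* u) (hHT b) xyz)
              (trans (cong (_++ (hHT b ++ xyz)) v-e) (++-assoc v (e ∷ []) (hHT b ++ xyz)))

  preimage-extendˡ : ∀ u → Preimage L u → ∃ λ d → Preimage L (d ∷ u)
  preimage-extendˡ u (a , b , h) with blocks-start-with-non2 u b | extendˡ* 3 (hHT a ++ h* u ++ hHT b) h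
  ... | f , v , f-v , f≢𝟐 | x ∷ y ∷ z ∷ [] , _ , h₃ with trailingBlock x y z in found
  ...   | just c with trailingBlock-sound x y z c found
  ...     | t , xyz≡ = a , c , b , subst L extended (suffix-closed t _ (subst L split h₃))
    where
    split : (x ∷ y ∷ z ∷ []) ++ hHT a ++ h* u ++ hHT b ≡ t ++ (hHT c ++ hHT a ++ h* u ++ hHT b)
    split = trans (cong (_++ (hHT a ++ h* u ++ hHT b)) xyz≡) (++-assoc t (hHT c) _)
    extended : hHT c ++ hHT a ++ h* u ++ hHT b ≡ hHT c ++ h* (a ∷ u) ++ hHT b
    extended = cong (hHT c ++_) (sym (++-assoc (hHT a) (h* u) (hHT b)))
  preimage-extendˡ u (a , b , h) | f , v , f-v , f≢𝟐 | x ∷ y ∷ z ∷ [] , _ , h₃ | nothing =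
    ⊥-elim (forbidden-∉ thue _ (previous-block-forced x y z a f f≢𝟐 found) (prefix-closed _ v (subst L split h₃)))
    where
    split : (x ∷ y ∷ z ∷ []) ++ hHT a ++ h* u ++ hHT b ≡ (x ∷ y ∷ z ∷ hHT a ++ f ∷ []) ++ v
    split = cong (λ q → x ∷ y ∷ z ∷ q) (trans (cong (hHT a ++_) f-v) (sym (++-assoc (hHT a) (f ∷ []) v)))

  𝟎-among-first-four : ∀ w → L w → 4 ≤ length w → ∃₂ λ q v → w ≡ q ++ 𝟎 ∷ v × length q ≤ 3
  𝟎-among-first-four []                   _ ()
  𝟎-among-first-four (_ ∷ [])             _ (s≤s ())
  𝟎-among-first-four (_ ∷ _ ∷ [])         _ (s≤s (s≤s ()))
  𝟎-among-first-four (_ ∷ _ ∷ _ ∷ [])     _ (s≤s (s≤s (s≤s ())))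
  𝟎-among-first-four (𝟎 ∷ w)             _ _ = [] , w , refl , z≤n
  𝟎-among-first-four (a ∷ 𝟎 ∷ w)         _ _ = a ∷ [] , w , refl , s≤s z≤n
  𝟎-among-first-four (a ∷ b ∷ 𝟎 ∷ w)     _ _ = a ∷ b ∷ [] , w , refl , s≤s (s≤s z≤n)
  𝟎-among-first-four (a ∷ b ∷ c ∷ 𝟎 ∷ w) _ _ = a ∷ b ∷ c ∷ [] , w , refl , s≤s (s≤s (s≤s z≤n))
  𝟎-among-first-four (𝟏 ∷ 𝟏 ∷ w)         h _ = ⊥-elim (∉-prefix (𝟏 ∷ 𝟏 ∷ []) w _ h)
  𝟎-among-first-four (𝟐 ∷ 𝟐 ∷ w)         h _ = ⊥-elim (∉-prefix (𝟐 ∷ 𝟐 ∷ []) w _ h)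
  𝟎-among-first-four (𝟏 ∷ 𝟐 ∷ 𝟐 ∷ w)     h _ = ⊥-elim (∉-prefix (𝟏 ∷ 𝟐 ∷ 𝟐 ∷ []) w _ h)
  𝟎-among-first-four (𝟐 ∷ 𝟏 ∷ 𝟏 ∷ w)     h _ = ⊥-elim (∉-prefix (𝟐 ∷ 𝟏 ∷ 𝟏 ∷ []) w _ h)
  𝟎-among-first-four (𝟐 ∷ 𝟏 ∷ 𝟐 ∷ w)     h _ = ⊥-elim (∉-prefix (𝟐 ∷ 𝟏 ∷ 𝟐 ∷ []) w _ h)
  𝟎-among-first-four (𝟏 ∷ 𝟐 ∷ 𝟏 ∷ 𝟏 ∷ w) h _ = ⊥-elim (∉-prefix (𝟏 ∷ 𝟐 ∷ 𝟏 ∷ 𝟏 ∷ []) w _ h)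
  𝟎-among-first-four (𝟏 ∷ 𝟐 ∷ 𝟏 ∷ 𝟐 ∷ w) h _ = ⊥-elim (∉-prefix (𝟏 ∷ 𝟐 ∷ 𝟏 ∷ 𝟐 ∷ []) w _ h)

  parse-from-𝟎 : ∀ w → L (𝟎 ∷ w) → ∃₂ λ v r → 𝟎 ∷ w ≡ h* v ++ r × length r ≤ 2
  parse-after-𝟐 : ∀ w → L (𝟐 ∷ w) → ∃₂ λ v r → w ≡ h* v ++ r × length r ≤ 2

  parse-from-𝟎 []           _ = [] , 𝟎 ∷ [] , refl , s≤s z≤n
  parse-from-𝟎 (𝟎 ∷ w)      h = ⊥-elim (∉-prefix (𝟎 ∷ 𝟎 ∷ []) w _ h)
  parse-from-𝟎 (𝟏 ∷ [])     _ = [] , 𝟎 ∷ 𝟏 ∷ [] , refl , s≤s (s≤s z≤n)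
  parse-from-𝟎 (𝟏 ∷ 𝟎 ∷ w)  h = ⊥-elim (∉-prefix (𝟎 ∷ 𝟏 ∷ 𝟎 ∷ []) w _ h)
  parse-from-𝟎 (𝟏 ∷ 𝟏 ∷ w)  h = ⊥-elim (∉-prefix (𝟎 ∷ 𝟏 ∷ 𝟏 ∷ []) w _ h)
  parse-from-𝟎 (𝟏 ∷ 𝟐 ∷ w)  h with parse-after-𝟐 w (suffix-closed (𝟎 ∷ 𝟏 ∷ []) (𝟐 ∷ w) h)
  ... | v , r , eq , r≤2 = 𝟎 ∷ v , r , cong (λ z → 𝟎 ∷ 𝟏 ∷ 𝟐 ∷ z) eq , r≤2
  parse-from-𝟎 (𝟐 ∷ w)      h with parse-after-𝟐 w (suffix-closed (𝟎 ∷ []) (𝟐 ∷ w) h)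
  ... | v , r , eq , r≤2 = 𝟏 ∷ v , r , cong (λ z → 𝟎 ∷ 𝟐 ∷ z) eq , r≤2

  parse-after-𝟐 []          _ = [] , [] , refl , z≤n
  parse-after-𝟐 (𝟎 ∷ w)     h = parse-from-𝟎 w (suffix-closed (𝟐 ∷ []) _ h)
  parse-after-𝟐 (𝟏 ∷ [])    _ = [] , 𝟏 ∷ [] , refl , s≤s z≤n
  parse-after-𝟐 (𝟏 ∷ 𝟎 ∷ w) h with parse-from-𝟎 w (suffix-closed (𝟐 ∷ 𝟏 ∷ []) _ h)
  ... | v , r , eq , r≤2 = 𝟐 ∷ v , r , cong (𝟏 ∷_) eq , r≤2
  parse-after-𝟐 (𝟏 ∷ 𝟏 ∷ w) h = ⊥-elim (∉-prefix (𝟐 ∷ 𝟏 ∷ 𝟏 ∷ []) w _ h)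
  parse-after-𝟐 (𝟏 ∷ 𝟐 ∷ w) h = ⊥-elim (∉-prefix (𝟐 ∷ 𝟏 ∷ 𝟐 ∷ []) w _ h)
  parse-after-𝟐 (𝟐 ∷ w)     h = ⊥-elim (∉-prefix (𝟐 ∷ 𝟐 ∷ []) w _ h)

  h*-growth : ∀ u → L u → 3 * length u ≤ 2 * length (h* u) + 1
  h*-growth []          _ = z≤n
  h*-growth (𝟎 ∷ u)     h = growth-step 1 3 _ _ (from-yes (3 ≤? 6)) (h*-growth u (suffix-closed (𝟎 ∷ []) u h))
  h*-growth (𝟏 ∷ u)     h = growth-step 1 2 _ _ (from-yes (3 ≤? 4)) (h*-growth u (suffix-closed (𝟏 ∷ []) u h))
  h*-growth (𝟐 ∷ [])    _ = from-yes (3 ≤? 3)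
  h*-growth (𝟐 ∷ 𝟎 ∷ u) h = growth-step 2 4 _ _ (from-yes (6 ≤? 8)) (h*-growth u (suffix-closed (𝟐 ∷ 𝟎 ∷ []) u h))
  h*-growth (𝟐 ∷ 𝟏 ∷ u) h = growth-step 2 3 _ _ (from-yes (6 ≤? 6)) (h*-growth u (suffix-closed (𝟐 ∷ 𝟏 ∷ []) u h))
  h*-growth (𝟐 ∷ 𝟐 ∷ u) h = ⊥-elim (∉-prefix (𝟐 ∷ 𝟐 ∷ []) u _ h)

  length-padded : (p w s : Word₃) → length p ≡ 6 → length s ≡ 5 → 11 ≤ length ((p ++ w) ++ s)
  length-padded p w s lp ls = begin
    11                                    ≤⟨ +-mono-≤ (m≤m+n 6 (length w)) (≤-refl {5}) ⟩
    (6 + length w) + 5                    ≡⟨ cong₂ (λ m n → (m + length w) + n) lp ls ⟨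
    (length p + length w) + length s      ≡⟨ cong (_+ length s) (length-++ p {w}) ⟨
    length (p ++ w) + length s            ≡⟨ length-++ (p ++ w) {s} ⟨
    length ((p ++ w) ++ s)                ∎
    where open ≤-Reasoning

  -- Kept abstract: unfolding this proof makes checking its uses impractically slow.
  abstract
    desubstitute : ∀ w → L w → ∃ λ u → Preimage L u × Infix w (h* u)
    desubstitute w w∈ with extendˡ* 6 w w∈
    ... | p , lp , pw∈ with extendʳ* 5 (p ++ w) pw∈
    ... | s , ls , pws∈ with 𝟎-among-first-four ((p ++ w) ++ s) pws∈ (≤-trans (from-yes (4 ≤? 11)) (length-padded p w s lp ls))
    ... | q , z , pws≡ , q≤3 with parse-from-𝟎 z (suffix-closed q (𝟎 ∷ z) (subst L pws≡ pws∈))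
    ... | v , r , 𝟎z≡ , r≤2 = from-parse v (trans pws≡ (cong (q ++_) 𝟎z≡))
      where
      open ≤-Reasoning

      long : 11 ≤ length ((p ++ w) ++ s)
      long = length-padded p w s lp ls

      not-too-short : ∀ x → length x ≤ 3 → (p ++ w) ++ s ≢ q ++ x ++ r
      not-too-short x x≤3 eq = from-no (11 ≤? 8) (begin
        11                                    ≤⟨ long ⟩
        length ((p ++ w) ++ s)                ≡⟨ cong length eq ⟩
        length (q ++ x ++ r)                  ≡⟨ length-++ q ⟩
        length q + length (x ++ r)            ≡⟨ cong (_+_ (length q)) (length-++ x) ⟩
        length q + (length x + length r)      ≤⟨ +-mono-≤ q≤3 (+-mono-≤ x≤3 r≤2) ⟩
        8                                     ∎)

      from-parse : ∀ v → (p ++ w) ++ s ≡ q ++ h* v ++ r → ∃ λ u → Preimage L u × Infix w (h* u)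
      from-parse []      eq = ⊥-elim (not-too-short [] z≤n eq)
      from-parse (a ∷ v) eq with initLast v
      ... | []       = ⊥-elim (not-too-short (hHT a ++ []) (subst (λ x → length x ≤ 3) (sym (++-identityʳ (hHT a))) (length-h≤3 a)) eq)
      ... | u ∷ʳ′ b = u , (a , b , infix-closed q _ r (subst L blocks pws∈)) ,
                      infix-inner p w s (q ++ hHT a) (h* u) (hHT b ++ r) aligned left-margin right-margin
        where
        blocks : (p ++ w) ++ s ≡ q ++ (hHT a ++ h* u ++ hHT b) ++ r
        blocks = trans eq (cong (λ z → q ++ (hHT a ++ z) ++ r) (h*-∷ʳ u b))
        aligned : p ++ w ++ s ≡ (q ++ hHT a) ++ h* u ++ (hHT b ++ r)
        aligned = trans (sym (++-assoc p w s)) (trans blocks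
          (solve 5 (λ Q A U B R → Q ⊕ (A ⊕ U ⊕ B) ⊕ R ⊜ (Q ⊕ A) ⊕ U ⊕ (B ⊕ R)) refl q (hHT a) (h* u) (hHT b) r))
        left-margin : length (q ++ hHT a) ≤ length p
        left-margin rewrite length-++ q {hHT a} | lp = +-mono-≤ q≤3 (length-h≤3 a)
        right-margin : length (hHT b ++ r) ≤ length s
        right-margin rewrite length-++ (hHT b) {r} | ls = +-mono-≤ (length-h≤3 b) r≤2

  preimage-contains-[] : Preimage L []
  preimage-contains-[] with desubstitute [] contains-[]
  ... | u , u∈ , _ = preimage-prefix-closed [] u u∈

  preimage-thue : ThueLanguage (Preimage L)
  preimage-thue = record
    { biextendable = record
      { contains-[]   = preimage-contains-[]
      ; prefix-closed = preimage-prefix-closed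
      ; suffix-closed = preimage-suffix-closed
      ; extendʳ       = preimage-extendʳ
      ; extendˡ       = preimage-extendˡ
      }
    ; square-free  = preimage-square-free
    ; ∌010         = preimage-∌010
    ; ∌212         = preimage-∌212
    }

module _ {A B : Set} (g : A → List B) (k : ℕ) (g-short : ∀ c → length (g c) ≤ suc k) where

  private
    g* : List A → List B
    g* = concatMap g

  trim-left : ∀ u (x w y : List B) → g* u ≡ x ++ w ++ y →
              ∃ λ u₁ → ∃₂ λ u₂ x′ → u ≡ u₁ ++ u₂ × g* u₂ ≡ x′ ++ w ++ y × length x′ ≤ k
  trim-left []      [] w y eq = [] , [] , [] , refl , eq , z≤n
  trim-left (c ∷ u) x  w y eq with length (g c) ≤? length x
  ... | yes gc≤x with ++-split (g c) (g* u) x (w ++ y) eq gc≤x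
  ...   | t , refl , eq′ with trim-left u t w y eq′
  ...     | u₁ , u₂ , x′ , refl , eq″ , x′≤k = c ∷ u₁ , u₂ , x′ , refl , eq″ , x′≤k
  trim-left (c ∷ u) x  w y eq | no gc≰x =
    [] , c ∷ u , x , refl , eq , ≤-pred (≤-trans (≰⇒> gc≰x) (g-short c))

  trim-right : ∀ u (x y : List B) → 1 ≤ length x → g* u ≡ x ++ y →
               ∃ λ u₁ → ∃₂ λ u₂ y′ → u ≡ u₁ ++ u₂ × g* u₁ ≡ x ++ y′ × length y′ ≤ k
  trim-right []      (_ ∷ _) y _   ()
  trim-right (c ∷ u) x       y 1≤x eq with length x ≤? length (g c)
  ... | yes x≤gc with ++-split x y (g c) (g* u) (sym eq) x≤gc
  ...   | t , gc≡ , _ = c ∷ [] , u , t , refl , trans (++-identityʳ (g c)) gc≡ , t≤k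
    where
    t≤k : length t ≤ k
    t≤k = ≤-pred (begin
      suc (length t)            ≤⟨ +-monoˡ-≤ (length t) 1≤x ⟩
      length x + length t       ≡⟨ length-++ x ⟨
      length (x ++ t)           ≡⟨ cong length gc≡ ⟨
      length (g c)              ≤⟨ g-short c ⟩
      suc k                     ∎)
      where open ≤-Reasoning
  trim-right (c ∷ u) x y 1≤x eq | no x≰gc with ++-split (g c) (g* u) x y eq (<⇒≤ (≰⇒> x≰gc))
  ...   | t , refl , eq′ with trim-right u t y 1≤t eq′
    where
    1≤t : 1 ≤ length t
    1≤t = +-cancelˡ-≤ (length (g c)) 1 (length t) (begin
      length (g c) + 1          ≡⟨ +-comm (length (g c)) 1 ⟩
      suc (length (g c))        ≤⟨ ≰⇒> x≰gc ⟩
      length (g c ++ t)         ≡⟨ length-++ (g c) ⟩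
      length (g c) + length t   ∎)
      where open ≤-Reasoning
  ...     | u₁ , u₂ , y′ , refl , eq″ , y′≤k =
    c ∷ u₁ , u₂ , y′ , refl , trans (cong (g c ++_) eq″) (sym (++-assoc (g c) t y′)) , y′≤k

  tight-preimage : ∀ u w → 1 ≤ length w → Infix w (g* u) →
                   ∃ λ u′ → Infix u′ u × Infix w (g* u′) × length (g* u′) ≤ length w + 2 * k
  tight-preimage u w 1≤w (x , y , eq) with trim-left u x w y eq
  ... | u₁ , u₂ , x′ , refl , eq′ , x′≤k with trim-right u₂ (x′ ++ w) y 1≤x′w (trans eq′ (sym (++-assoc x′ w y)))
    where
    1≤x′w : 1 ≤ length (x′ ++ w)
    1≤x′w = ≤-trans 1≤w (subst (length w ≤_) (sym (length-++ x′)) (m≤n+m (length w) (length x′)))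
  ... | u₃ , u₄ , y′ , refl , eq″ , y′≤k =
    u₃ , (u₁ , u₄ , refl) , (x′ , y′ , trans eq″ (++-assoc x′ w y′)) , bound
    where
    open ≤-Reasoning
    bound : length (g* u₃) ≤ length w + 2 * k
    bound = begin
      length (g* u₃)                      ≡⟨ cong length eq″ ⟩
      length ((x′ ++ w) ++ y′)            ≡⟨ length-++ (x′ ++ w) ⟩
      length (x′ ++ w) + length y′        ≡⟨ cong (_+ length y′) (length-++ x′) ⟩
      length x′ + length w + length y′    ≤⟨ +-mono-≤ (+-monoˡ-≤ (length w) x′≤k) y′≤k ⟩
      k + length w + k                    ≡⟨ cong (_+ k) (+-comm k (length w)) ⟩
      length w + k + k                    ≡⟨ +-assoc (length w) k k ⟩
      length w + (k + k)                  ≡⟨ cong (λ n → length w + (k + n)) (+-identityʳ k) ⟨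
      length w + 2 * k                    ∎

preimage-shorter : ∀ a b w → 3 * a ≤ 2 * b + 1 → b ≤ w + 4 → 9 < w → a < w
preimage-shorter a b w a≤b b≤w 9<w = *-cancelˡ-< 3 a w (begin-strict
  3 * a               ≤⟨ a≤b ⟩
  2 * b + 1           ≤⟨ +-monoˡ-≤ 1 (*-monoʳ-≤ 2 b≤w) ⟩
  2 * (w + 4) + 1     ≡⟨ cong (_+ 1) (*-distribˡ-+ 2 w 4) ⟩
  2 * w + 8 + 1       ≡⟨ +-assoc (2 * w) 8 1 ⟩
  2 * w + 9           <⟨ +-monoʳ-< (2 * w) 9<w ⟩
  2 * w + w           ≡⟨ +-comm (2 * w) w ⟩
  3 * w               ∎)
  where open ≤-Reasoning

thue-language⇒HallThueFactor : ∀ n {L} → ThueLanguage L → ∀ w → length w ≤ n → L w → HallThueFactor w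
thue-language⇒HallThueFactor n thue w w≤n w∈ with length w ≤? 9
... | yes w≤9 = short-factor thue w w≤9 w∈
thue-language⇒HallThueFactor zero    thue w w≤0 w∈ | no w≰9 = ⊥-elim (w≰9 (≤-trans w≤0 z≤n))
thue-language⇒HallThueFactor (suc n) {L} thue w w≤n w∈ | no w≰9
  with desubstitute thue w w∈
... | u , u∈ , w⊑ with tight-preimage hHT 2 length-h≤3 u w (≤-trans (s≤s z≤n) (≰⇒> w≰9)) w⊑
... | u′ , u′⊑u , w⊑′ , short =
  HallThueFactor-infix w⊑′ (HallThueFactor-h* (thue-language⇒HallThueFactor n (preimage-thue thue) u′ u′-shorter u′∈))
  where
  u′∈ : Preimage L u′
  u′∈ = ThueLanguage.Infix-closed (preimage-thue thue) u′⊑u u∈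
  u′-shorter : length u′ ≤ n
  u′-shorter = ≤-pred (≤-trans (preimage-shorter _ _ _ (h*-growth (preimage-thue thue) u′ u′∈) short (≰⇒> w≰9)) w≤n)

h^-∈ : ∀ n {L} → ThueLanguage L → L (h^ n)
h^-∈ zero    thue with ThueLanguage.extendʳ* thue 4 [] (ThueLanguage.contains-[] thue)
... | w , len , w∈ with 𝟎-among-first-four thue w w∈ (≤-reflexive (sym len))
... | q , v , refl , _ = ThueLanguage.infix-closed thue q (𝟎 ∷ []) v w∈
h^-∈ (suc n) {L} thue = subst L (sym (h^-suc n)) (blocks-∈ thue (h^ n) (h^-∈ n (preimage-thue thue)))

thue-language⇔HallThueFactor : ∀ {L} → ThueLanguage L → ∀ w → L w ⇔ HallThueFactor w
thue-language⇔HallThueFactor thue w = mk⇔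
  (thue-language⇒HallThueFactor (length w) thue w ≤-refl)
  (λ (n , w⊑) → ThueLanguage.Infix-closed thue w⊑ (h^-∈ n thue))

module _ {B : Set} (d : B) where

  PrefixOfℕ : List B → (ℕ → B) → Set
  PrefixOfℕ W y = ∀ j → j < length W → y j ≡ nth d W j

  nth-IsPrefix : ∀ {u w} j → IsPrefix u w → j < length u → nth d u j ≡ nth d w j
  nth-IsPrefix {a ∷ u} zero    (t , refl) _        = refl
  nth-IsPrefix {a ∷ u} (suc j) (t , refl) (s≤s j<) = nth-IsPrefix {u} j (t , refl) j<

  drop-nth : ∀ W i → i < length W → drop i W ≡ nth d W i ∷ drop (suc i) W
  drop-nth (a ∷ W) zero    _        = refl
  drop-nth (a ∷ W) (suc i) (s≤s i<) = drop-nth W i i<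

  length-sliceℕ : ∀ (y : ℕ → B) i m → length (sliceℕ y i m) ≡ m
  length-sliceℕ y i zero    = refl
  length-sliceℕ y i (suc m) = cong suc (length-sliceℕ y (suc i) m)

  drop-sliceℕ : ∀ {W y} → PrefixOfℕ W y → ∀ i m → i + m ≤ length W →
                drop i W ≡ sliceℕ y i m ++ drop (i + m) W
  drop-sliceℕ {W} prefix i zero    _    rewrite +-identityʳ i = refl
  drop-sliceℕ {W} prefix i (suc m) i+m< rewrite +-suc i m =
    trans (drop-nth W i (≤-trans (s≤s (m≤m+n i m)) i+m<))
      (cong₂ _∷_ (sym (prefix i (≤-trans (s≤s (m≤m+n i m)) i+m<))) (drop-sliceℕ {W} prefix (suc i) m i+m<))

  sliceℕ-IsPrefix : ∀ {W y} → PrefixOfℕ W y → ∀ m → m ≤ length W → IsPrefix (sliceℕ y 0 m) W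
  sliceℕ-IsPrefix {W} prefix m m≤ = drop m W , sym (drop-sliceℕ {W} prefix 0 m m≤)

  module _ {y : ℕ → B} (W : ℕ → List B) (prefix : ∀ n → PrefixOfℕ (W n) y)
           (long : ∀ n → n ≤ length (W n)) where

    FactorOfℕ⇔Infix : ∀ w → FactorOfℕ w y ⇔ ∃ λ n → Infix w (W n)
    FactorOfℕ⇔Infix w = mk⇔ factor⇒infix infix⇒factor
      where
      factor⇒infix : FactorOfℕ w y → ∃ λ n → Infix w (W n)
      factor⇒infix (i , slice≡w) = n , take i (W n) , drop n (W n) , (begin
        W n                                             ≡⟨ take++drop≡id i (W n) ⟨
        take i (W n) ++ drop i (W n)                    ≡⟨ cong (take i (W n) ++_) (drop-sliceℕ (prefix n) i (length w) (long n)) ⟩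
        take i (W n) ++ sliceℕ y i (length w) ++ drop n (W n)
                                                        ≡⟨ cong (λ v → take i (W n) ++ v ++ drop n (W n)) slice≡w ⟩
        take i (W n) ++ w ++ drop n (W n)               ∎)
        where
        open ≡-Reasoning
        n : ℕ
        n = i + length w

      infix⇒factor : (∃ λ n → Infix w (W n)) → FactorOfℕ w y
      infix⇒factor (n , p , s , Wn≡) = length p , proj₁ (++-injective _ (drop (length p + length w) (W n)) w s
          (length-sliceℕ y (length p) (length w)) (sym w++s≡))
        where
        open ≤-Reasoning
        bound : length p + length w ≤ length (W n)
        bound = begin
          length p + length w                   ≤⟨ m≤m+n (length p + length w) (length s) ⟩
          length p + length w + length s        ≡⟨ +-assoc (length p) (length w) (length s) ⟩
          length p + (length w + length s)      ≡⟨ cong (_+_ (length p)) (length-++ w) ⟨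
          length p + length (w ++ s)            ≡⟨ length-++ p ⟨
          length (p ++ w ++ s)                  ≡⟨ cong length Wn≡ ⟨
          length (W n)                          ∎
        w++s≡ : w ++ s ≡ sliceℕ y (length p) (length w) ++ drop (length p + length w) (W n)
        w++s≡ = trans (sym (drop-length-++ p (w ++ s)))
                  (trans (cong (drop (length p)) (sym Wn≡)) (drop-sliceℕ (prefix n) (length p) (length w) bound))

IsPrefix-trans : ∀ {A : Set} {u v w : List A} → IsPrefix u v → IsPrefix v w → IsPrefix u w
IsPrefix-trans {u = u} (t , refl) (t′ , refl) = t ++ t′ , sym (++-assoc u t t′)

concatMap-IsPrefix : ∀ {A B : Set} (k : A → List B) {u w} → IsPrefix u w → IsPrefix (concatMap k u) (concatMap k w)
concatMap-IsPrefix k {u} (t , refl) = concatMap k t , sym (concatMap-++ k u t)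

length-concatMap : ∀ {A B : Set} (k : A → List B) → (∀ c → 1 ≤ length (k c)) →
                   ∀ u → length u ≤ length (concatMap k u)
length-concatMap k nonempty []      = z≤n
length-concatMap k nonempty (c ∷ u) rewrite length-++ (k c) {concatMap k u} =
  +-mono-≤ (nonempty c) (length-concatMap k nonempty u)

h^-IsPrefix-suc : ∀ n → IsPrefix (h^ n) (h^ (suc n))
h^-IsPrefix-suc zero    = 𝟏 ∷ 𝟐 ∷ [] , refl
h^-IsPrefix-suc (suc n) with h^-IsPrefix-suc n
... | t , eq = h* t , (begin
  h^ (suc n) ++ h* t      ≡⟨ cong (_++ h* t) (h^-suc n) ⟩
  h* (h^ n) ++ h* t       ≡⟨ h*-++ (h^ n) t ⟨
  h* (h^ n ++ t)          ≡⟨ cong h* eq ⟩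
  h* (h^ (suc n))         ≡⟨ h^-suc (suc n) ⟨
  h^ (suc (suc n))        ∎)
  where open ≡-Reasoning

h^-IsPrefix : ∀ {m n} → m ≤′ n → IsPrefix (h^ m) (h^ n)
h^-IsPrefix ≤′-refl         = [] , ++-identityʳ _
h^-IsPrefix {n = suc n} (≤′-step m≤′n) = IsPrefix-trans (h^-IsPrefix m≤′n) (h^-IsPrefix-suc n)

length-h^ : ∀ n → suc n ≤ length (h^ n)
length-h^ zero    = s≤s z≤n
length-h^ (suc n) with h^-IsPrefix {0} {n} (≤⇒≤′ z≤n)
... | t , eq = begin
  suc (suc n)               ≤⟨ s≤s (length-h^ n) ⟩
  suc (length (h^ n))       ≡⟨ cong (suc ∘ length) eq ⟨
  suc (suc (length t))      ≤⟨ s≤s (s≤s (≤-trans (length-concatMap hHT 1≤length-h t) (n≤1+n _))) ⟩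
  length (h* (𝟎 ∷ t))       ≡⟨ cong (length ∘ h*) eq ⟩
  length (h* (h^ n))        ≡⟨ cong length (h^-suc n) ⟨
  length (h^ (suc n))       ∎
  where open ≤-Reasoning

b3-agrees : ∀ n → PrefixOfℕ 𝟎 (h^ n) b3
b3-agrees n j j< = begin
  nth 𝟎 (h^ (suc j)) j     ≡⟨ nth-IsPrefix 𝟎 j (h^-IsPrefix (≤⇒≤′ (m≤n⊔m n (suc j)))) (≤-trans (n≤1+n _) (length-h^ (suc j))) ⟩
  nth 𝟎 (h^ (n ⊔ suc j)) j ≡⟨ nth-IsPrefix 𝟎 j (h^-IsPrefix (≤⇒≤′ (m≤m⊔n n (suc j)))) j< ⟨
  nth 𝟎 (h^ n) j           ∎
  where open ≡-Reasoning

module _ {B : Set} (d : B) (k : Fin 3 → List B) (nonempty : ∀ c → 1 ≤ length (k c)) where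

  image-agrees : ∀ n → PrefixOfℕ d (concatMap k (h^ n)) (applyInf d k b3)
  image-agrees n j j< = begin
    nth d (concatMap k slice) j                 ≡⟨ nth-IsPrefix d j (concatMap-IsPrefix k slice⊑) j<slice ⟩
    nth d (concatMap k (h^ (n ⊔ suc j))) j      ≡⟨ nth-IsPrefix d j (concatMap-IsPrefix k (h^-IsPrefix (≤⇒≤′ (m≤m⊔n n (suc j))))) j< ⟨
    nth d (concatMap k (h^ n)) j                ∎
    where
    open ≡-Reasoning
    slice : List (Fin 3)
    slice = sliceℕ b3 0 (suc j)
    slice⊑ : IsPrefix slice (h^ (n ⊔ suc j))
    slice⊑ = sliceℕ-IsPrefix 𝟎 (b3-agrees (n ⊔ suc j)) (suc j)
               (≤-trans (m≤n⊔m n (suc j)) (≤-trans (n≤1+n _) (length-h^ (n ⊔ suc j))))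
    j<slice : j < length (concatMap k slice)
    j<slice = ≤-trans (≤-reflexive (sym (length-sliceℕ 𝟎 b3 0 (suc j)))) (length-concatMap k nonempty slice)

  applyInf-factors : ∀ w → FactorOfℕ w (applyInf d k b3) ⇔ ∃ λ n → Infix w (concatMap k (h^ n))
  applyInf-factors = FactorOfℕ⇔Infix d (λ n → concatMap k (h^ n)) image-agrees
    (λ n → ≤-trans (n≤1+n n) (≤-trans (length-h^ n) (length-concatMap k nonempty (h^ n))))

module OverlapFreeCoding
  {A : Set} (x : ℤ → A) (free : OverlapFreeℤ x) (one : A) (k : Fin 3 → List A)
  (k-starts-with-one : ∀ c → ∃ λ t → k c ≡ one ∷ t)
  (block-before : ∀ w → FactorOfℤ (one ∷ w) x → ∃ λ c → FactorOfℤ (k c ++ one ∷ w) x)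
  (parse : ∀ w → FactorOfℤ (one ∷ w) x → ∃₂ λ u r → one ∷ w ≡ concatMap k u ++ one ∷ r × length r ≤ 3)
  (reach-one : ∀ c w → FactorOfℤ (c ∷ w) x → ∃₂ λ q w′ → q ++ c ∷ w ≡ one ∷ w′ × FactorOfℤ (one ∷ w′) x)
  (∌k010 : ¬ FactorOfℤ (concatMap k (𝟎 ∷ 𝟏 ∷ 𝟎 ∷ []) ++ one ∷ []) x)
  (∌k212 : ∀ a b → a ≢ 𝟐 → b ≢ 𝟐 → ¬ FactorOfℤ (concatMap k (a ∷ 𝟐 ∷ 𝟏 ∷ 𝟐 ∷ b ∷ []) ++ one ∷ []) x)
  where

  open MonoidSolver (++-monoid A) using (solve; _⊕_; _⊜_)
  open Biextendable (factorsℤ-biextendable x)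

  Factor : List A → Set
  Factor w = FactorOfℤ w x

  k* : Word₃ → List A
  k* = concatMap k

  k*-++ : ∀ u v → k* (u ++ v) ≡ k* u ++ k* v
  k*-++ = concatMap-++ k

  -- Every block starts with one, so appending one turns the image of a square into an overlap.
  Coded : Word₃ → Set
  Coded u = Factor (k* u ++ one ∷ [])

  k*-one : ∀ v r → ∃ λ r′ → k* v ++ one ∷ r ≡ one ∷ r′
  k*-one []      r = r , refl
  k*-one (c ∷ v) r with k-starts-with-one c
  ... | t , kc≡ = t ++ k* v ++ one ∷ r , trans (++-assoc (k c) (k* v) (one ∷ r)) (cong (_++ (k* v ++ one ∷ r)) kc≡)

  coded-prefix-closed : ∀ u v → Coded (u ++ v) → Coded u
  coded-prefix-closed u v h with k*-one v []
  ... | r , eq = prefix-closed (k* u ++ one ∷ []) r (subst Factor split h)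
    where
    split : k* (u ++ v) ++ one ∷ [] ≡ (k* u ++ one ∷ []) ++ r
    split = trans (cong (_++ one ∷ []) (k*-++ u v)) (trans (++-assoc (k* u) (k* v) (one ∷ []))
              (trans (cong (k* u ++_) eq) (sym (++-assoc (k* u) (one ∷ []) r))))

  coded-suffix-closed : ∀ u v → Coded (u ++ v) → Coded v
  coded-suffix-closed u v h =
    suffix-closed (k* u) _ (subst Factor (trans (cong (_++ one ∷ []) (k*-++ u v)) (++-assoc (k* u) (k* v) (one ∷ []))) h)

  coded-square-free : ∀ a u → ¬ Coded ((a ∷ u) ++ (a ∷ u))
  coded-square-free a u h with k-starts-with-one a
  ... | t , ka≡ = overlap-free⇒¬auaua x free one (t ++ k* u) (subst Factor as-overlap h)
    where
    as-overlap : k* ((a ∷ u) ++ (a ∷ u)) ++ one ∷ [] ≡ (one ∷ t ++ k* u) ++ (one ∷ t ++ k* u) ++ one ∷ []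
    as-overlap = trans (cong (_++ one ∷ []) (k*-++ (a ∷ u) (a ∷ u)))
                (trans (++-assoc (k a ++ k* u) (k a ++ k* u) (one ∷ []))
                  (cong (λ z → (z ++ k* u) ++ (z ++ k* u) ++ one ∷ []) ka≡))

  coded-extendˡ : ∀ u → Coded u → ∃ λ c → Coded (c ∷ u)
  coded-extendˡ u h with k*-one u []
  ... | r , eq with block-before r (subst Factor eq h)
  ... | c , h′ = c , subst Factor (trans (cong (k c ++_) (sym eq)) (sym (++-assoc (k c) (k* u) (one ∷ [])))) h′

  coded-extendʳ : ∀ u → Coded u → ∃ λ c → Coded (u ++ c ∷ [])
  coded-extendʳ u h with extendʳ* 4 (k* u ++ one ∷ []) h
  ... | s , len , h₄ with parse s (suffix-closed (k* u) (one ∷ s) (subst Factor (++-assoc (k* u) (one ∷ []) s) h₄))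
  ... | [] , r , eq , r≤3 = ⊥-elim (4≰3 (subst (_≤ 3) (trans (cong length (sym (proj₂ (∷-injective eq)))) len) r≤3))
    where
    4≰3 : ¬ 4 ≤ 3
    4≰3 (s≤s (s≤s (s≤s ())))
  ... | c ∷ v , r , eq , _ with k*-one v r
  ... | r′ , eq′ = c , prefix-closed _ r′ (subst Factor split h₄)
    where
    open ≡-Reasoning
    split : (k* u ++ one ∷ []) ++ s ≡ (k* (u ++ c ∷ []) ++ one ∷ []) ++ r′
    split = begin
      (k* u ++ one ∷ []) ++ s                 ≡⟨ ++-assoc (k* u) (one ∷ []) s ⟩
      k* u ++ one ∷ s                         ≡⟨ cong (k* u ++_) eq ⟩
      k* u ++ (k c ++ k* v) ++ one ∷ r        ≡⟨ cong (k* u ++_) (++-assoc (k c) (k* v) (one ∷ r)) ⟩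
      k* u ++ k c ++ k* v ++ one ∷ r          ≡⟨ cong (λ z → k* u ++ k c ++ z) eq′ ⟩
      k* u ++ k c ++ one ∷ r′                 ≡⟨ solve 4 (λ U C O R → U ⊕ (C ⊕ (O ⊕ R)) ⊜ ((U ⊕ C) ⊕ O) ⊕ R) refl (k* u) (k c) (one ∷ []) r′ ⟩
      ((k* u ++ k c) ++ one ∷ []) ++ r′       ≡⟨ cong (λ z → (z ++ one ∷ []) ++ r′) (trans (k*-++ u (c ∷ [])) (cong (k* u ++_) (++-identityʳ (k c)))) ⟨
      (k* (u ++ c ∷ []) ++ one ∷ []) ++ r′    ∎

  coded-∌212 : ¬ Coded (𝟐 ∷ 𝟏 ∷ 𝟐 ∷ [])
  coded-∌212 h with coded-extendˡ (𝟐 ∷ 𝟏 ∷ 𝟐 ∷ []) h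
  ... | a , h₁ with coded-extendʳ (a ∷ 𝟐 ∷ 𝟏 ∷ 𝟐 ∷ []) h₁
  ... | b , h₂ = in-context a b h₂
    where
    in-context : ∀ a b → ¬ Coded (a ∷ 𝟐 ∷ 𝟏 ∷ 𝟐 ∷ b ∷ [])
    in-context 𝟐 b h = coded-square-free 𝟐 [] (coded-prefix-closed (𝟐 ∷ 𝟐 ∷ []) (𝟏 ∷ 𝟐 ∷ b ∷ []) h)
    in-context 𝟎 𝟐 h = coded-square-free 𝟐 [] (coded-suffix-closed (𝟎 ∷ 𝟐 ∷ 𝟏 ∷ []) (𝟐 ∷ 𝟐 ∷ []) h)
    in-context 𝟏 𝟐 h = coded-square-free 𝟐 [] (coded-suffix-closed (𝟏 ∷ 𝟐 ∷ 𝟏 ∷ []) (𝟐 ∷ 𝟐 ∷ []) h)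
    in-context 𝟎 𝟎 h = ∌k212 𝟎 𝟎 (λ ()) (λ ()) h
    in-context 𝟎 𝟏 h = ∌k212 𝟎 𝟏 (λ ()) (λ ()) h
    in-context 𝟏 𝟎 h = ∌k212 𝟏 𝟎 (λ ()) (λ ()) h
    in-context 𝟏 𝟏 h = ∌k212 𝟏 𝟏 (λ ()) (λ ()) h

  coded-contains-[] : Coded []
  coded-contains-[] with extendʳ [] contains-[]
  ... | c , h with reach-one c [] h
  ... | _ , w , _ , h′ = prefix-closed (one ∷ []) w h′

  coded-thue : ThueLanguage Coded
  coded-thue = record
    { biextendable = record
      { contains-[]   = coded-contains-[]
      ; prefix-closed = coded-prefix-closed
      ; suffix-closed = coded-suffix-closed
      ; extendʳ       = coded-extendʳ
      ; extendˡ       = coded-extendˡ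
      }
    ; square-free  = coded-square-free
    ; ∌010         = ∌k010
    ; ∌212         = coded-∌212
    }

  decode : ∀ w → Factor w → ∃ λ u → Coded u × Infix w (k* u)
  decode w h with extendʳ* 4 w h
  ... | s , len , h₄ with w ++ s in ws≡
  ... | [] = ⊥-elim (0≢n+4 (trans (sym (cong length ws≡)) (trans (length-++ w) (cong (_+_ (length w)) len))))
    where
    0≢n+4 : ∀ {n} → 0 ≢ n + 4
    0≢n+4 {zero}  ()
    0≢n+4 {suc n} ()
  ... | c ∷ v with reach-one c v h₄
  ... | q , v′ , qcv≡ , h₅ with parse v′ h₅
  ... | u , r , parsed , r≤3 =
    u , prefix-closed (k* u ++ one ∷ []) r (subst Factor (sym (++-assoc (k* u) (one ∷ []) r)) (subst Factor parsed h₅)) ,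
    infix-inner q w s [] (k* u) (one ∷ r) (trans (cong (q ++_) ws≡) (trans qcv≡ parsed)) z≤n
      (≤-trans (s≤s r≤3) (≤-reflexive (sym len)))

  factors⇔image-factors : ∀ w → Factor w ⇔ ∃ λ n → Infix w (k* (h^ n))
  factors⇔image-factors w = mk⇔ factor⇒image image⇒factor
    where
    k*-infix : ∀ {u v} → Infix u v → Infix (k* u) (k* v)
    k*-infix {u} (p , s , refl) = k* p , k* s , trans (k*-++ p (u ++ s)) (cong (k* p ++_) (k*-++ u s))

    factor⇒image : Factor w → ∃ λ n → Infix w (k* (h^ n))
    factor⇒image h with decode w h
    ... | u , u∈ , w⊑ with to (thue-language⇔HallThueFactor coded-thue u) u∈
    ... | n , u⊑ = n , infix-trans w⊑ (k*-infix u⊑)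

    image⇒factor : (∃ λ n → Infix w (k* (h^ n))) → Factor w
    image⇒factor (n , w⊑) = Infix-closed w⊑ (prefix-closed (k* (h^ n)) (one ∷ []) (h^-∈ n coded-thue))

  k-nonempty : ∀ c → 1 ≤ length (k c)
  k-nonempty c with k-starts-with-one c
  ... | t , kc≡ rewrite kc≡ = s≤s z≤n

  factors⇔applyInf-factors : ∀ d w → Factor w ⇔ FactorOfℕ w (applyInf d k b3)
  factors⇔applyInf-factors d w = ⇔-sym (applyInf-factors d k k-nonempty w) ⇔-∘ factors⇔image-factors w

module P₄-walk (x : ℤ → Fin 4) (walk : IsWalkℤ EdgeP4 x) (free : OverlapFreeℤ x) where

  open Biextendable (factorsℤ-biextendable x)

  Factor : List (Fin 4) → Set
  Factor w = FactorOfℤ w x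

  back : ∀ c w → Factor (c ∷ w) → ∃ λ d → EdgeP4 d c × Factor (d ∷ c ∷ w)
  back = walk-extendˡ x walk

  edge : ∀ p a b w → Factor (p ++ a ∷ b ∷ w) → EdgeP4 a b
  edge = walk-edge-at x walk

  ∌23232 : ∀ p w → ¬ Factor (p ++ 𝟐 ∷ 𝟑 ∷ 𝟐 ∷ 𝟑 ∷ 𝟐 ∷ w)
  ∌23232 p w h = overlap-free⇒¬auaua x free 𝟐 (𝟑 ∷ []) (infix-closed p (𝟐 ∷ 𝟑 ∷ 𝟐 ∷ 𝟑 ∷ 𝟐 ∷ []) w h)

  k4-starts-with-𝟏 : ∀ c → ∃ λ t → k4 c ≡ 𝟏 ∷ t
  k4-starts-with-𝟏 𝟎 = _ , refl
  k4-starts-with-𝟏 𝟏 = _ , refl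
  k4-starts-with-𝟏 𝟐 = _ , refl

  block-before : ∀ w → Factor (𝟏 ∷ w) → ∃ λ c → Factor (k4 c ++ 𝟏 ∷ w)
  block-before w h with back _ w h
  ... | _ , e01 , h₁ with back _ _ h₁
  ...   | _ , e10 , h₂ = 𝟐 , h₂
  block-before w h | _ , e21 , h₁ with back _ _ h₁
  ...   | _ , e12 , h₂ = 𝟏 , h₂
  ...   | _ , e32 , h₂ with back _ _ h₂
  ...     | _ , e23 , h₃ with back _ _ h₃
  ...       | _ , e12 , h₄ = 𝟎 , h₄
  ...       | _ , e32 , h₄ with back _ _ h₄
  ...         | _ , e23 , h₅ = ⊥-elim (∌23232 [] _ h₅)

  parse : ∀ w → Factor (𝟏 ∷ w) → ∃₂ λ u r → 𝟏 ∷ w ≡ concatMap k4 u ++ 𝟏 ∷ r × length r ≤ 3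
  parse []      h = [] , [] , refl , z≤n
  parse (c ∷ w) h with edge [] 𝟏 c w h
  parse (.𝟎 ∷ [])    h | e10 = [] , 𝟎 ∷ [] , refl , s≤s z≤n
  parse (.𝟎 ∷ c ∷ w) h | e10 with edge (𝟏 ∷ []) 𝟎 c w h
  ... | e01 with parse w (suffix-closed (𝟏 ∷ 𝟎 ∷ []) _ h)
  ...   | u , r , eq , r≤3 = 𝟐 ∷ u , r , cong (λ z → 𝟏 ∷ 𝟎 ∷ z) eq , r≤3
  parse (.𝟐 ∷ [])    h | e12 = [] , 𝟐 ∷ [] , refl , s≤s z≤n
  parse (.𝟐 ∷ c ∷ w) h | e12 with edge (𝟏 ∷ []) 𝟐 c w h
  ... | e21 with parse w (suffix-closed (𝟏 ∷ 𝟐 ∷ []) _ h)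
  ...   | u , r , eq , r≤3 = 𝟏 ∷ u , r , cong (λ z → 𝟏 ∷ 𝟐 ∷ z) eq , r≤3
  parse (.𝟐 ∷ .𝟑 ∷ []) h | e12 | e23 = [] , 𝟐 ∷ 𝟑 ∷ [] , refl , s≤s (s≤s z≤n)
  parse (.𝟐 ∷ .𝟑 ∷ c ∷ w) h | e12 | e23 with edge (𝟏 ∷ 𝟐 ∷ []) 𝟑 c w h
  parse (.𝟐 ∷ .𝟑 ∷ .𝟐 ∷ []) h | e12 | e23 | e32 = [] , 𝟐 ∷ 𝟑 ∷ 𝟐 ∷ [] , refl , s≤s (s≤s (s≤s z≤n))
  parse (.𝟐 ∷ .𝟑 ∷ .𝟐 ∷ c ∷ w) h | e12 | e23 | e32 with edge (𝟏 ∷ 𝟐 ∷ 𝟑 ∷ []) 𝟐 c w h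
  ... | e21 with parse w (suffix-closed (𝟏 ∷ 𝟐 ∷ 𝟑 ∷ 𝟐 ∷ []) _ h)
  ...   | u , r , eq , r≤3 = 𝟎 ∷ u , r , cong (λ z → 𝟏 ∷ 𝟐 ∷ 𝟑 ∷ 𝟐 ∷ z) eq , r≤3
  parse (.𝟐 ∷ .𝟑 ∷ .𝟐 ∷ .𝟑 ∷ w) h | e12 | e23 | e32 | e23
    with extendʳ (𝟏 ∷ 𝟐 ∷ 𝟑 ∷ 𝟐 ∷ 𝟑 ∷ []) (prefix-closed (𝟏 ∷ 𝟐 ∷ 𝟑 ∷ 𝟐 ∷ 𝟑 ∷ []) w h)
  ... | c , h′ with edge (𝟏 ∷ 𝟐 ∷ 𝟑 ∷ 𝟐 ∷ []) 𝟑 c [] h′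
  ...   | e32 = ⊥-elim (∌23232 (𝟏 ∷ []) [] h′)

  reach-𝟏 : ∀ c w → Factor (c ∷ w) → ∃₂ λ q w′ → q ++ c ∷ w ≡ 𝟏 ∷ w′ × Factor (𝟏 ∷ w′)
  reach-𝟏 𝟏 w h = [] , w , refl , h
  reach-𝟏 𝟎 w h with back _ w h
  ... | _ , e10 , h₁ = 𝟏 ∷ [] , _ , refl , h₁
  reach-𝟏 𝟐 w h with back _ w h
  ... | _ , e12 , h₁ = 𝟏 ∷ [] , _ , refl , h₁
  ... | _ , e32 , h₁ with back _ _ h₁
  ...   | _ , e23 , h₂ with back _ _ h₂
  ...     | _ , e12 , h₃ = 𝟏 ∷ 𝟐 ∷ 𝟑 ∷ [] , _ , refl , h₃
  ...     | _ , e32 , h₃ with back _ _ h₃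
  ...       | _ , e23 , h₄ = ⊥-elim (∌23232 [] w h₄)
  reach-𝟏 𝟑 w h with back _ w h
  ... | _ , e23 , h₁ with back _ _ h₁
  ...   | _ , e12 , h₂ = 𝟏 ∷ 𝟐 ∷ [] , _ , refl , h₂
  ...   | _ , e32 , h₂ with back _ _ h₂
  ...     | _ , e23 , h₃ with back _ _ h₃
  ...       | _ , e12 , h₄ = 𝟏 ∷ 𝟐 ∷ 𝟑 ∷ 𝟐 ∷ [] , _ , refl , h₄
  ...       | _ , e32 , h₄ with back _ _ h₄
  ...         | _ , e23 , h₅ = ⊥-elim (∌23232 [] (𝟑 ∷ w) h₅)

  ∌k010 : ¬ Factor (concatMap k4 (𝟎 ∷ 𝟏 ∷ 𝟎 ∷ []) ++ 𝟏 ∷ [])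
  ∌k010 h = overlap-free⇒¬auaua x free 𝟐 (𝟏 ∷ [])
    (infix-closed (𝟏 ∷ 𝟐 ∷ 𝟑 ∷ []) (𝟐 ∷ 𝟏 ∷ 𝟐 ∷ 𝟏 ∷ 𝟐 ∷ []) (𝟑 ∷ 𝟐 ∷ 𝟏 ∷ []) h)

  ∌k212 : ∀ a b → a ≢ 𝟐 → b ≢ 𝟐 → ¬ Factor (concatMap k4 (a ∷ 𝟐 ∷ 𝟏 ∷ 𝟐 ∷ b ∷ []) ++ 𝟏 ∷ [])
  ∌k212 𝟎 𝟎 _ _ h = overlap-free⇒¬auaua x free 𝟐 (𝟏 ∷ 𝟎 ∷ 𝟏 ∷ []) (infix-closed (𝟏 ∷ 𝟐 ∷ 𝟑 ∷ []) _ (𝟑 ∷ 𝟐 ∷ 𝟏 ∷ []) h)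
  ∌k212 𝟎 𝟏 _ _ h = overlap-free⇒¬auaua x free 𝟐 (𝟏 ∷ 𝟎 ∷ 𝟏 ∷ []) (infix-closed (𝟏 ∷ 𝟐 ∷ 𝟑 ∷ []) _ (𝟏 ∷ []) h)
  ∌k212 𝟏 𝟎 _ _ h = overlap-free⇒¬auaua x free 𝟐 (𝟏 ∷ 𝟎 ∷ 𝟏 ∷ []) (infix-closed (𝟏 ∷ []) _ (𝟑 ∷ 𝟐 ∷ 𝟏 ∷ []) h)
  ∌k212 𝟏 𝟏 _ _ h = overlap-free⇒¬auaua x free 𝟐 (𝟏 ∷ 𝟎 ∷ 𝟏 ∷ []) (infix-closed (𝟏 ∷ []) _ (𝟏 ∷ []) h)
  ∌k212 𝟐 _ a≢𝟐 _ = ⊥-elim (a≢𝟐 refl)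
  ∌k212 _ 𝟐 _ b≢𝟐 = ⊥-elim (b≢𝟐 refl)

  open OverlapFreeCoding x free 𝟏 k4 k4-starts-with-𝟏 block-before parse reach-𝟏 ∌k010 ∌k212
    using (factors⇔applyInf-factors)

  factors⇔k4b3-factors : ∀ w → Factor w ⇔ FactorOfℕ w k4b3
  factors⇔k4b3-factors = factors⇔applyInf-factors 𝟎

module P₃*-walk (x : ℤ → Fin 3) (walk : IsWalkℤ EdgeP3s x) (free : OverlapFreeℤ x) where

  open Biextendable (factorsℤ-biextendable x)

  Factor : List (Fin 3) → Set
  Factor w = FactorOfℤ w x

  back : ∀ c w → Factor (c ∷ w) → ∃ λ d → EdgeP3s d c × Factor (d ∷ c ∷ w)
  back = walk-extendˡ x walk

  edge : ∀ p a b w → Factor (p ++ a ∷ b ∷ w) → EdgeP3s a b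
  edge = walk-edge-at x walk

  ∌222 : ∀ p w → ¬ Factor (p ++ 𝟐 ∷ 𝟐 ∷ 𝟐 ∷ w)
  ∌222 p w h = overlap-free⇒¬auaua x free 𝟐 [] (infix-closed p (𝟐 ∷ 𝟐 ∷ 𝟐 ∷ []) w h)

  k3-starts-with-𝟏 : ∀ c → ∃ λ t → k3 c ≡ 𝟏 ∷ t
  k3-starts-with-𝟏 𝟎 = _ , refl
  k3-starts-with-𝟏 𝟏 = _ , refl
  k3-starts-with-𝟏 𝟐 = _ , refl

  block-before : ∀ w → Factor (𝟏 ∷ w) → ∃ λ c → Factor (k3 c ++ 𝟏 ∷ w)
  block-before w h with back _ w h
  ... | _ , e01 , h₁ with back _ _ h₁
  ...   | _ , e10 , h₂ = 𝟐 , h₂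
  block-before w h | _ , e21 , h₁ with back _ _ h₁
  ...   | _ , e12 , h₂ = 𝟏 , h₂
  ...   | _ , e22 , h₂ with back _ _ h₂
  ...     | _ , e12 , h₃ = 𝟎 , h₃
  ...     | _ , e22 , h₃ = ⊥-elim (∌222 [] _ h₃)

  parse : ∀ w → Factor (𝟏 ∷ w) → ∃₂ λ u r → 𝟏 ∷ w ≡ concatMap k3 u ++ 𝟏 ∷ r × length r ≤ 3
  parse []      h = [] , [] , refl , z≤n
  parse (c ∷ w) h with edge [] 𝟏 c w h
  parse (.𝟎 ∷ [])    h | e10 = [] , 𝟎 ∷ [] , refl , s≤s z≤n
  parse (.𝟎 ∷ c ∷ w) h | e10 with edge (𝟏 ∷ []) 𝟎 c w h
  ... | e01 with parse w (suffix-closed (𝟏 ∷ 𝟎 ∷ []) _ h)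
  ...   | u , r , eq , r≤3 = 𝟐 ∷ u , r , cong (λ z → 𝟏 ∷ 𝟎 ∷ z) eq , r≤3
  parse (.𝟐 ∷ [])    h | e12 = [] , 𝟐 ∷ [] , refl , s≤s z≤n
  parse (.𝟐 ∷ c ∷ w) h | e12 with edge (𝟏 ∷ []) 𝟐 c w h
  ... | e21 with parse w (suffix-closed (𝟏 ∷ 𝟐 ∷ []) _ h)
  ...   | u , r , eq , r≤3 = 𝟏 ∷ u , r , cong (λ z → 𝟏 ∷ 𝟐 ∷ z) eq , r≤3
  parse (.𝟐 ∷ .𝟐 ∷ []) h | e12 | e22 = [] , 𝟐 ∷ 𝟐 ∷ [] , refl , s≤s (s≤s z≤n)
  parse (.𝟐 ∷ .𝟐 ∷ c ∷ w) h | e12 | e22 with edge (𝟏 ∷ 𝟐 ∷ []) 𝟐 c w h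
  ... | e21 with parse w (suffix-closed (𝟏 ∷ 𝟐 ∷ 𝟐 ∷ []) _ h)
  ...   | u , r , eq , r≤3 = 𝟎 ∷ u , r , cong (λ z → 𝟏 ∷ 𝟐 ∷ 𝟐 ∷ z) eq , r≤3
  parse (.𝟐 ∷ .𝟐 ∷ .𝟐 ∷ w) h | e12 | e22 | e22 = ⊥-elim (∌222 (𝟏 ∷ []) w h)

  reach-𝟏 : ∀ c w → Factor (c ∷ w) → ∃₂ λ q w′ → q ++ c ∷ w ≡ 𝟏 ∷ w′ × Factor (𝟏 ∷ w′)
  reach-𝟏 𝟏 w h = [] , w , refl , h
  reach-𝟏 𝟎 w h with back _ w h
  ... | _ , e10 , h₁ = 𝟏 ∷ [] , _ , refl , h₁
  reach-𝟏 𝟐 w h with back _ w h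
  ... | _ , e12 , h₁ = 𝟏 ∷ [] , _ , refl , h₁
  ... | _ , e22 , h₁ with back _ _ h₁
  ...   | _ , e12 , h₂ = 𝟏 ∷ 𝟐 ∷ [] , _ , refl , h₂
  ...   | _ , e22 , h₂ = ⊥-elim (∌222 [] w h₂)

  ∌k010 : ¬ Factor (concatMap k3 (𝟎 ∷ 𝟏 ∷ 𝟎 ∷ []) ++ 𝟏 ∷ [])
  ∌k010 h = overlap-free⇒¬auaua x free 𝟐 (𝟏 ∷ [])
    (infix-closed (𝟏 ∷ 𝟐 ∷ []) (𝟐 ∷ 𝟏 ∷ 𝟐 ∷ 𝟏 ∷ 𝟐 ∷ []) (𝟐 ∷ 𝟏 ∷ []) h)

  ∌k212 : ∀ a b → a ≢ 𝟐 → b ≢ 𝟐 → ¬ Factor (concatMap k3 (a ∷ 𝟐 ∷ 𝟏 ∷ 𝟐 ∷ b ∷ []) ++ 𝟏 ∷ [])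
  ∌k212 𝟎 𝟎 _ _ h = overlap-free⇒¬auaua x free 𝟐 (𝟏 ∷ 𝟎 ∷ 𝟏 ∷ []) (infix-closed (𝟏 ∷ 𝟐 ∷ []) _ (𝟐 ∷ 𝟏 ∷ []) h)
  ∌k212 𝟎 𝟏 _ _ h = overlap-free⇒¬auaua x free 𝟐 (𝟏 ∷ 𝟎 ∷ 𝟏 ∷ []) (infix-closed (𝟏 ∷ 𝟐 ∷ []) _ (𝟏 ∷ []) h)
  ∌k212 𝟏 𝟎 _ _ h = overlap-free⇒¬auaua x free 𝟐 (𝟏 ∷ 𝟎 ∷ 𝟏 ∷ []) (infix-closed (𝟏 ∷ []) _ (𝟐 ∷ 𝟏 ∷ []) h)
  ∌k212 𝟏 𝟏 _ _ h = overlap-free⇒¬auaua x free 𝟐 (𝟏 ∷ 𝟎 ∷ 𝟏 ∷ []) (infix-closed (𝟏 ∷ []) _ (𝟏 ∷ []) h)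
  ∌k212 𝟐 _ a≢𝟐 _ = ⊥-elim (a≢𝟐 refl)
  ∌k212 _ 𝟐 _ b≢𝟐 = ⊥-elim (b≢𝟐 refl)

  open OverlapFreeCoding x free 𝟏 k3 k3-starts-with-𝟏 block-before parse reach-𝟏 ∌k010 ∌k212
    using (factors⇔applyInf-factors)

  factors⇔k3b3-factors : ∀ w → Factor w ⇔ FactorOfℕ w k3b3
  factors⇔k3b3-factors = factors⇔applyInf-factors 𝟎

theorem7 : ((x : ℤ → Fin 4) → IsWalkℤ EdgeP4 x → OverlapFreeℤ x →
    (w : List (Fin 4)) → FactorOfℤ w x ⇔ FactorOfℕ w k4b3)
    ×
    ((x : ℤ → Fin 3) → IsWalkℤ EdgeP3s x → OverlapFreeℤ x →
    (w : List (Fin 3)) → FactorOfℤ w x ⇔ FactorOfℕ w k3b3)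
theorem7 = P₄-walk.factors⇔k4b3-factors , P₃*-walk.factors⇔k3b3-factors
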